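{- Let $m$ be odd. If a monomial $\prod_{\alpha=1}^{m-1}y_{i_\alpha j_\alpha k_\alpha}$ occurs with non-zero coefficient in $\mathcal P_m^2$, then there exists $p\in\{1,2,\dots,m\}$ which occurs exactly twice in the list of indices $i_1,j_1,k_1,i_2,j_2,k_2,\dots,i_{m-1},j_{m-1},k_{m-1}$.
   Context: Let $y_{ijk}$ ($i,j,k\in\{1,\dots,m\}$) be indeterminates, totally antisymmetric in their indices ($y_{ijk}=-y_{jik}=y_{jki}$, $y_{iij}=0$). Let $\Lambda=(\lambda_{ij})_{1\le i,j\le m}$ with $\lambda_{ij}=\sum_k y_{ijk}$. The Pfaffian-tree polynomial is $\mathcal P_m=(-1)^{p-1}\operatorname{Pf}(\Lambda^{(p)})$, where $\Lambda^{(p)}$ is $\Lambda$ with the $p$th row and column removed (independent of $p$). It is homogeneous of degree $(m-1)/2$, so $\mathcal P_m^2$ is homogeneous of degree $m-1$ in the independent variables $y_{ijk}$, $i<j<k$. -}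

module Defs where

open import Data.Nat as ℕ using (ℕ; zero; suc; _≡ᵇ_; _<ᵇ_)
open import Data.Integer using (ℤ; +_; -_) renaming (_*_ to _*ℤ_; _+_ to _+ℤ_)
open import Data.Fin using (Fin; toℕ)
open import Data.Fin.Properties using () renaming (_≟_ to _≟F_)
open import Data.List using (List; []; _∷_; [_]; _++_; map; concatMap; filter; length; drop; foldr)
open import Data.List using (allFin) public
open import Data.Product using (_×_; _,_)
open import Data.Product.Properties using (≡-dec)
open import Data.Bool using (Bool; if_then_else_; _∨_; _∧_; true)

-- A variable y_{ijk} is named by a triple of indices (0-based: Fin m).
Var : ℕ → Set
Var m = Fin m × Fin m × Fin m

-- A monomial is a list (multiset) of variables; a polynomial with integer
-- coefficients is a finite formal sum (list) of terms  c · monomial.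
Mono : ℕ → Set
Mono m = List (Var m)

Poly : ℕ → Set
Poly m = List (ℤ × Mono m)

module _ {m : ℕ} where

  0P : Poly m
  0P = []

  1P : Poly m
  1P = [ (+ 1 , []) ]

  _+P_ : Poly m → Poly m → Poly m
  p +P q = p ++ q

  scale : ℤ → Poly m → Poly m
  scale c = map (λ { (a , M) → (c *ℤ a , M) })

  _*P_ : Poly m → Poly m → Poly m
  p *P q = concatMap (λ { (a , M) → map (λ { (b , N) → (a *ℤ b , M ++ N) }) q }) p

  -- the independent variable y_{ijk} with i < j < k, as a polynomial
  var : Fin m → Fin m → Fin m → Poly m
  var i j k = [ (+ 1 , [ (i , j , k) ]) ]

  private
    lt eq : Fin m → Fin m → Bool
    lt a b = toℕ a <ᵇ toℕ b
    eq a b = toℕ a ≡ᵇ toℕ b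

  -- y_{ijk} for arbitrary indices, by total antisymmetry expressed through
  -- the independent variables y_{abc}, a < b < c (zero if two indices agree)
  y : Fin m → Fin m → Fin m → Poly m
  y i j k =
    if eq i j ∨ eq j k ∨ eq i k then 0P else
    (if lt i j
      then (if lt j k then var i j k
            else if lt i k then scale (- + 1) (var i k j)
            else var k i j)
      else (if lt i k then scale (- + 1) (var j i k)
            else if lt j k then var j k i
            else scale (- + 1) (var k j i)))

  Λ : Fin m → Fin m → Poly m
  Λ i j = concatMap (y i j) (allFin m)

  picks : {A : Set} → List A → List (A × List A)
  picks [] = []
  picks (x ∷ xs) = (x , xs) ∷ map (λ { (z , zs) → (z , x ∷ zs) }) (picks xs)

  alt : ℤ → List (Poly m) → Poly m
  alt c [] = 0P
  alt c (p ∷ ps) = scale c p +P alt (- c) ps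

  -- Pfaffian of the principal submatrix of A on the (ordered) index list,
  -- by expansion along the first row:
  --   Pf(A) = Σ_{j=2}^{2n} (-1)^j a_{1j} Pf(A with rows/cols 1,j removed).
  -- The ℕ argument is fuel (any value ≥ length of the list suffices).
  pf : (Fin m → Fin m → Poly m) → ℕ → List (Fin m) → Poly m
  pf A _ [] = 1P
  pf A zero (_ ∷ _) = 0P
  pf A (suc n) (i ∷ rest) =
    alt (+ 1) (map (λ { (j , r) → A i j *P pf A n r }) (picks rest))

-- Pfaffian-tree polynomial  P_m = (-1)^{p-1} Pf(Λ^{(p)}) taken with p = 1
-- (so the sign is +1): Λ with the first row and column removed.
𝒫 : (m : ℕ) → Poly m
𝒫 m = pf Λ m (drop 1 (allFin m))

countV : {m : ℕ} → Var m → Mono m → ℕ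
countV v M = length (filter (λ u → ≡-dec _≟F_ (≡-dec _≟F_ _≟F_) u v) M)

allVars : (m : ℕ) → List (Var m)
allVars m = concatMap (λ i → concatMap (λ j → map (λ k → (i , j , k)) (allFin m)) (allFin m)) (allFin m)

allB : {A : Set} → (A → Bool) → List A → Bool
allB f = foldr (λ a b → f a ∧ b) true

sameMono : {m : ℕ} → Mono m → Mono m → Bool
sameMono {m} M N = allB (λ v → countV v M ≡ᵇ countV v N) (allVars m)

coeff : {m : ℕ} → Poly m → Mono m → ℤ
coeff P M = foldr (λ { (a , N) s → if sameMono N M then a +ℤ s else s }) (+ 0) P

indices : {m : ℕ} → Mono m → List (Fin m)
indices = concatMap (λ { (i , j , k) → i ∷ j ∷ k ∷ [] })

occ : {m : ℕ} → Fin m → List (Fin m) → ℕ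
occ p l = length (filter (λ q → q ≟F p) l)

module Submission where

-- Split 𝒫 m = A + B, where A collects the terms in which the deleted index p does not
-- occur. A is the Pfaffian of the matrix Λ′ obtained from Λ by dropping every y_{ijk}
-- involving p. Its column sums ∑_i λ′_{ij} = ∑_{i,k ≠ p} y_{ijk} vanish by antisymmetry
-- in i and k, so expanding along a row writes Pf Λ′ as a combination of Pfaffians with a
-- repeated index, which vanish: A = 0. Each term of Pf Λ^{(p)} is a product of entries
-- λ_{ij} over a perfect matching of the remaining indices, and each term of λ_{ij}
-- involves i and j, so every term of B involves every index. Hence every monomial of
-- 𝒫 m ² involves every index at least twice; having only 3(m - 1) < 3m index slots,
-- it involves some index exactly twice.

open import Defs
open import Algebra.Bundles using (CommutativeRing)
open import Level using (0ℓ)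
open import Data.Bool using (Bool; true; false; if_then_else_; _∧_; T)
open import Data.Bool.Properties using (T-∧; T-≡; ¬-not)
open import Data.Empty using (⊥-elim)
open import Data.Fin as Fin using (Fin; toℕ; _<_)
import Data.Fin.Properties as FinP
open import Data.Integer as Int using (ℤ; +_)
import Data.Integer.Properties as ℤP
open import Data.List as List using (List; []; _∷_; _++_; map; concatMap; filter; length; drop)
import Data.List.Properties as ListP
open import Data.List.Membership.Propositional using (_∈_; find)
open import Data.List.Membership.Propositional.Properties
  using (∈-∃++; ∈-map⁺; ∈-map⁻; ∈-concat⁺′; ∈-concatMap⁻; ∈-allFin; ∈-++⁺ˡ; ∈-++⁺ʳ; ∈-++⁻; ∈-filter⁻; ∈-tabulate⁺)
open import Data.List.Relation.Binary.Permutation.Propositional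
  using (_↭_; ↭-refl; ↭-prep; ↭-swap; ↭-trans; ↭-sym)
open import Data.List.Relation.Binary.Permutation.Propositional.Properties using (∈-resp-↭)
open import Data.List.Relation.Unary.All as All using (All; []; _∷_)
open import Data.List.Relation.Unary.Any using (here; there)
open import Data.Nat as ℕ using (ℕ; zero; suc; _≤_; _∸_; _%_; _≡ᵇ_; _<ᵇ_)
import Data.Nat.Properties as ℕP
open import Data.Product using (_×_; _,_; proj₁; proj₂; ∃; ∃-syntax)
open import Data.Product.Properties using (≡-dec)
open import Data.Sum as Sum using (_⊎_; inj₁; inj₂; [_,_])
open import Function using (_∘_)
open import Relation.Binary.PropositionalEquality as ≡ using (_≡_)
open import Relation.Binary.Definitions using (DecidableEquality; tri<; tri≈; tri>)
open import Relation.Nullary using (¬_; Dec; yes; no; does)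
open import Relation.Nullary.Decidable using (¬?)
open import Relation.Unary using (Decidable)
open import Function.Bundles using (Equivalence; _⇔_; mk⇔)

module Sums {c ℓ} (R : CommutativeRing c ℓ) where

  open CommutativeRing R
  open import Algebra.Properties.Ring ring
  open import Algebra.Properties.CommutativeSemigroup +-commutativeSemigroup using (interchange; x∙yz≈y∙xz)
  open import Relation.Binary.Reasoning.Setoid setoid

  ∑ : {X : Set} → List X → (X → Carrier) → Carrier
  ∑ []       f = 0#
  ∑ (x ∷ xs) f = f x + ∑ xs f

  ∑± : {X : Set} → List X → (X → Carrier) → Carrier
  ∑± []       f = 0#
  ∑± (x ∷ xs) f = f x - ∑± xs f

  -‿--distrib : ∀ x y → - (x - y) ≈ - x - - y
  -‿--distrib x y = sym (-‿+-comm x (- y))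

  x-[y-z]≈x-y+z : ∀ x y z → x - (y - z) ≈ (x - y) + z
  x-[y-z]≈x-y+z x y z = begin
    x - (y - z)        ≈⟨ +-congˡ (-‿--distrib y z) ⟩
    x + (- y - - z)    ≈⟨ +-congˡ (+-congˡ (-‿involutive z)) ⟩
    x + (- y + z)      ≈⟨ sym (+-assoc x (- y) z) ⟩
    (x - y) + z        ∎

  module _ {X : Set} where

    ∑-cong : (xs : List X) {f g : X → Carrier} → (∀ x → f x ≈ g x) → ∑ xs f ≈ ∑ xs g
    ∑-cong []       e = refl
    ∑-cong (x ∷ xs) e = +-cong (e x) (∑-cong xs e)

    ∑-+ : (xs : List X) (f g : X → Carrier) → ∑ xs (λ x → f x + g x) ≈ ∑ xs f + ∑ xs g
    ∑-+ []       f g = sym (+-identityˡ 0#)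
    ∑-+ (x ∷ xs) f g = trans (+-congˡ (∑-+ xs f g)) (interchange (f x) (g x) _ _)

    ∑-neg : (xs : List X) (f : X → Carrier) → ∑ xs (λ x → - f x) ≈ - ∑ xs f
    ∑-neg []       f = sym -0#≈0#
    ∑-neg (x ∷ xs) f = trans (+-congˡ (∑-neg xs f)) (-‿+-comm (f x) (∑ xs f))

    ∑-*ʳ : (xs : List X) (f : X → Carrier) (k : Carrier) → ∑ xs (λ x → f x * k) ≈ ∑ xs f * k
    ∑-*ʳ []       f k = sym (zeroˡ k)
    ∑-*ʳ (x ∷ xs) f k = trans (+-congˡ (∑-*ʳ xs f k)) (sym (distribʳ k (f x) (∑ xs f)))

    ∑-++ : (xs ys : List X) (f : X → Carrier) → ∑ (xs ++ ys) f ≈ ∑ xs f + ∑ ys f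
    ∑-++ []       ys f = sym (+-identityˡ _)
    ∑-++ (x ∷ xs) ys f = trans (+-congˡ (∑-++ xs ys f)) (sym (+-assoc (f x) _ _))

    ∑-map : {Y : Set} (h : Y → X) (ys : List Y) (f : X → Carrier) → ∑ (map h ys) f ≡ ∑ ys (f ∘ h)
    ∑-map h []       f = ≡.refl
    ∑-map h (y ∷ ys) f = ≡.cong (λ s → f (h y) + s) (∑-map h ys f)

    ∑-*ˡ : (xs : List X) (k : Carrier) (f : X → Carrier) → ∑ xs (λ x → k * f x) ≈ k * ∑ xs f
    ∑-*ˡ []       k f = sym (zeroʳ k)
    ∑-*ˡ (x ∷ xs) k f = trans (+-congˡ (∑-*ˡ xs k f)) (sym (distribˡ k (f x) (∑ xs f)))

    ∑-0 : (xs : List X) → ∑ xs (λ _ → 0#) ≈ 0#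
    ∑-0 []       = refl
    ∑-0 (x ∷ xs) = trans (+-identityˡ _) (∑-0 xs)

    ∑-vanish : (xs : List X) (f : X → Carrier) → (∀ x → x ∈ xs → f x ≈ 0#) → ∑ xs f ≈ 0#
    ∑-vanish []       f e = refl
    ∑-vanish (x ∷ xs) f e =
      trans (+-cong (e x (here ≡.refl)) (∑-vanish xs f (λ y y∈ → e y (there y∈)))) (+-identityˡ 0#)

    ∑-partition : {P : X → Set} (P? : Decidable P) (xs : List X) (f : X → Carrier) →
                  ∑ xs f ≈ ∑ (filter P? xs) f + ∑ (filter (¬? ∘ P?) xs) f
    ∑-partition P? []       f = sym (+-identityˡ 0#)
    ∑-partition P? (x ∷ xs) f with P? x
    ... | yes _ = trans (+-congˡ (∑-partition P? xs f)) (sym (+-assoc (f x) _ _))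
    ... | no  _ = trans (+-congˡ (∑-partition P? xs f)) (x∙yz≈y∙xz (f x) _ _)

    ∑±-cong : (xs : List X) {f g : X → Carrier} → (∀ x → f x ≈ g x) → ∑± xs f ≈ ∑± xs g
    ∑±-cong []       e = refl
    ∑±-cong (x ∷ xs) e = +-cong (e x) (-‿cong (∑±-cong xs e))

    ∑±-map : {Y : Set} (h : Y → X) (ys : List Y) (f : X → Carrier) → ∑± (map h ys) f ≡ ∑± ys (f ∘ h)
    ∑±-map h []       f = ≡.refl
    ∑±-map h (y ∷ ys) f = ≡.cong (λ s → f (h y) - s) (∑±-map h ys f)

    ∑±-+ : (xs : List X) (f g : X → Carrier) → ∑± xs (λ x → f x + g x) ≈ ∑± xs f + ∑± xs g
    ∑±-+ []       f g = sym (+-identityˡ 0#)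
    ∑±-+ (x ∷ xs) f g = begin
      (f x + g x) - ∑± xs (λ x → f x + g x)  ≈⟨ +-congˡ (-‿cong (∑±-+ xs f g)) ⟩
      (f x + g x) - (∑± xs f + ∑± xs g)      ≈⟨ +-congˡ (sym (-‿+-comm _ _)) ⟩
      (f x + g x) + (- ∑± xs f - ∑± xs g)    ≈⟨ interchange (f x) (g x) _ _ ⟩
      (f x - ∑± xs f) + (g x - ∑± xs g)      ∎

    ∑±-neg : (xs : List X) (f : X → Carrier) → ∑± xs (λ x → - f x) ≈ - ∑± xs f
    ∑±-neg []       f = sym -0#≈0#
    ∑±-neg (x ∷ xs) f = trans (+-congˡ (-‿cong (∑±-neg xs f))) (sym (-‿--distrib (f x) (∑± xs f)))

    ∑±-- : (xs : List X) (f g : X → Carrier) → ∑± xs (λ x → f x - g x) ≈ ∑± xs f - ∑± xs g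
    ∑±-- xs f g = trans (∑±-+ xs f (λ x → - g x)) (+-congˡ (∑±-neg xs g))

    ∑±-*ˡ : (xs : List X) (k : Carrier) (f : X → Carrier) → ∑± xs (λ x → k * f x) ≈ k * ∑± xs f
    ∑±-*ˡ []       k f = sym (zeroʳ k)
    ∑±-*ˡ (x ∷ xs) k f = trans (+-congˡ (-‿cong (∑±-*ˡ xs k f))) (sym (x[y-z]≈xy-xz k (f x) (∑± xs f)))

    ∑±-0 : (xs : List X) → ∑± xs (λ _ → 0#) ≈ 0#
    ∑±-0 xs = trans (∑±-cong xs (λ _ → sym (zeroˡ 0#))) (trans (∑±-*ˡ xs 0# (λ _ → 0#)) (zeroˡ _))

  ∑±-∑ : {X Y : Set} (xs : List X) (ys : List Y) (f : Y → X → Carrier) →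
         ∑± xs (λ x → ∑ ys (λ y → f y x)) ≈ ∑ ys (λ y → ∑± xs (f y))
  ∑±-∑ xs []       f = ∑±-0 xs
  ∑±-∑ xs (y ∷ ys) f = trans (∑±-+ xs (f y) _) (+-congˡ (∑±-∑ xs ys f))

  ∑-swap : {X Y : Set} (xs : List X) (ys : List Y) (f : X → Y → Carrier) →
           ∑ xs (λ x → ∑ ys (f x)) ≈ ∑ ys (λ y → ∑ xs (λ x → f x y))
  ∑-swap []       ys f = sym (∑-0 ys)
  ∑-swap (x ∷ xs) ys f = trans (+-congˡ (∑-swap xs ys f)) (sym (∑-+ ys (f x) _))

module Pfaffian {c ℓ} (R : CommutativeRing c ℓ) where

  open CommutativeRing R
  open import Algebra.Properties.Ring ring
  open import Relation.Binary.Reasoning.Setoid setoid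
  open Sums R
  open import Algebra.Properties.CommutativeSemigroup *-commutativeSemigroup using (x∙yz≈y∙xz)

  -- Defs' picks has a spurious implicit ℕ parameter; its value is irrelevant.
  choices : {I : Set} → List I → List (I × List I)
  choices = picks {0}

  pfaffian : {I : Set} → (I → I → Carrier) → ℕ → List I → Carrier
  pfaffian A _       []         = 1#
  pfaffian A zero    (_ ∷ _)    = 0#
  pfaffian A (suc n) (i ∷ rest) = ∑± (choices rest) (λ (j , r) → A i j * pfaffian A n r)

  module _ {I : Set} where

    private
      ∑±² : (I → I → List I → Carrier) → List I → Carrier
      ∑±² F L = ∑± (choices L) (λ (x , r) → ∑± (choices r) (λ (y , s) → F x y s))

      ∑±²-cong : (L : List I) {F G : I → I → List I → Carrier} →
                 (∀ x y r → F x y r ≈ G x y r) → ∑±² F L ≈ ∑±² G L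
      ∑±²-cong L e = ∑±-cong (choices L) (λ (x , r) → ∑±-cong (choices r) (λ (y , s) → e x y s))

      ∑±²-∷ : (F : I → I → List I → Carrier) (c : I) (L : List I) →
              ∑±² F (c ∷ L) ≈ ∑± (choices L) (λ (x , r) → F c x r - F x c r)
                              + ∑±² (λ x y r → F x y (c ∷ r)) L
      ∑±²-∷ F c L = begin
        ∑±² F (c ∷ L)
          ≈⟨ +-congˡ (-‿cong (reflexive (∑±-map _ (choices L) _))) ⟩
        Fc- - ∑± (choices L) (λ (x , r) → ∑± (choices (c ∷ r)) (λ (y , s) → F x y s))
          ≈⟨ +-congˡ (-‿cong (∑±-cong (choices L) (λ (x , r) →
               +-congˡ (-‿cong (reflexive (∑±-map _ (choices r) _)))))) ⟩
        Fc- - ∑± (choices L) (λ (x , r) → F x c r - ∑± (choices r) (λ (y , s) → F x y (c ∷ s)))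
          ≈⟨ +-congˡ (-‿cong (∑±-- (choices L) _ _)) ⟩
        Fc- - (F-c - ∑±² (λ x y r → F x y (c ∷ r)) L)
          ≈⟨ x-[y-z]≈x-y+z Fc- F-c _ ⟩
        (Fc- - F-c) + ∑±² (λ x y r → F x y (c ∷ r)) L
          ≈⟨ +-congʳ (sym (∑±-- (choices L) _ _)) ⟩
        ∑± (choices L) (λ (x , r) → F c x r - F x c r) + ∑±² (λ x y r → F x y (c ∷ r)) L ∎
        where
          Fc- F-c : Carrier
          Fc- = ∑± (choices L) (λ (x , r) → F c x r)
          F-c = ∑± (choices L) (λ (x , r) → F x c r)

      ∑±²-antisym : (L : List I) (F : I → I → List I → Carrier) →
                    ∑±² F L ≈ - ∑±² (λ x y r → F y x r) L
      ∑±²-antisym []      F = sym -0#≈0#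
      ∑±²-antisym (c ∷ L) F = begin
        ∑±² F (c ∷ L)                 ≈⟨ ∑±²-∷ F c L ⟩
        D + ∑±² Fc L                  ≈⟨ +-cong (sym (-‿involutive D)) (∑±²-antisym L Fc) ⟩
        - - D + - ∑±² (flipF Fc) L    ≈⟨ +-congʳ (-‿cong (sym D′≈-D)) ⟩
        - D′ + - ∑±² (flipF Fc) L     ≈⟨ -‿+-comm D′ _ ⟩
        - (D′ + ∑±² (flipF Fc) L)     ≈⟨ -‿cong (sym (∑±²-∷ (flipF F) c L)) ⟩
        - ∑±² (flipF F) (c ∷ L)       ∎
        where
          flipF : (I → I → List I → Carrier) → I → I → List I → Carrier
          flipF G x y r = G y x r
          Fc : I → I → List I → Carrier
          Fc x y r = F x y (c ∷ r)
          D D′ : Carrier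
          D  = ∑± (choices L) (λ (x , r) → F c x r - F x c r)
          D′ = ∑± (choices L) (λ (x , r) → F x c r - F c x r)
          D′≈-D : D′ ≈ - D
          D′≈-D = trans (∑±-cong (choices L) (λ (x , r) → sym (⁻¹-anti-homo‿- (F c x r) (F x c r))))
                        (∑±-neg (choices L) _)

    module _ (A : I → I → Carrier) (A-antisym : ∀ i j → A j i ≈ - A i j) where

      private
        tail : ℕ → I → I → List I → Carrier
        tail m a b L = ∑± (choices L) (λ (x , r) → A a x * pfaffian A m (b ∷ r))

        pfaffian-∷∷ : ∀ m a b L → pfaffian A (suc m) (a ∷ b ∷ L) ≈ A a b * pfaffian A m L - tail m a b L
        pfaffian-∷∷ m a b L = +-congˡ (-‿cong (reflexive (∑±-map _ (choices L) _)))

        tail-antisym : ∀ m a b L → tail m a b L ≈ - tail m b a L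
        tail-antisym zero a b L = begin
          tail 0 a b L          ≈⟨ tail0 a b ⟩
          0#                    ≈⟨ sym -0#≈0# ⟩
          - 0#                  ≈⟨ -‿cong (sym (tail0 b a)) ⟩
          - tail 0 b a L        ∎
          where
            tail0 : ∀ a b → tail 0 a b L ≈ 0#
            tail0 a b = trans (∑±-cong (choices L) (λ _ → zeroʳ _)) (∑±-0 (choices L))
        tail-antisym (suc n) a b L = begin
          tail (suc n) a b L    ≈⟨ ∑±-cong (choices L) (λ (x , r) → sym (∑±-*ˡ (choices r) (A a x) _)) ⟩
          ∑±² (F a b) L         ≈⟨ ∑±²-antisym L (F a b) ⟩
          - ∑±² (λ x y r → F a b y x r) L
            ≈⟨ -‿cong (∑±²-cong L (λ x y r → x∙yz≈y∙xz (A a y) (A b x) _)) ⟩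
          - ∑±² (F b a) L       ≈⟨ -‿cong (∑±-cong (choices L) (λ (x , r) → ∑±-*ˡ (choices r) (A b x) _)) ⟩
          - tail (suc n) b a L  ∎
          where
            F : I → I → I → I → List I → Carrier
            F a b x y r = A a x * (A b y * pfaffian A n r)

      pfaffian-swap-head : ∀ m a b L → pfaffian A m (a ∷ b ∷ L) ≈ - pfaffian A m (b ∷ a ∷ L)
      pfaffian-swap-head zero    a b L = sym -0#≈0#
      pfaffian-swap-head (suc m) a b L = begin
        pfaffian A (suc m) (a ∷ b ∷ L)            ≈⟨ pfaffian-∷∷ m a b L ⟩
        A a b * P - tail m a b L                   ≈⟨ +-cong Aab≈-Aba (-‿cong (tail-antisym m a b L)) ⟩
        - (A b a * P) - - tail m b a L             ≈⟨ sym (-‿--distrib _ _) ⟩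
        - (A b a * P - tail m b a L)               ≈⟨ -‿cong (sym (pfaffian-∷∷ m b a L)) ⟩
        - pfaffian A (suc m) (b ∷ a ∷ L)          ∎
        where
          P = pfaffian A m L
          Aab≈-Aba : A a b * P ≈ - (A b a * P)
          Aab≈-Aba = trans (*-congʳ (A-antisym b a)) (sym (-‿distribˡ-* (A b a) P))

      ∑±-choices-swap : ∀ a b P R (g : I × List I → Carrier) →
        (∀ x Q R′ → g (x , Q ++ a ∷ b ∷ R′) ≈ - g (x , Q ++ b ∷ a ∷ R′)) →
        ∑± (choices (P ++ a ∷ b ∷ R)) g ≈ - ∑± (choices (P ++ b ∷ a ∷ R)) g
      ∑±-choices-swap a b [] R g g-swap = begin
        u - (v - W)            ≈⟨ x-[y-z]≈x-y+z u v W ⟩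
        (u - v) + W            ≈⟨ +-cong (sym (⁻¹-anti-homo‿- v u)) W≈-W′ ⟩
        - (v - u) + - W′       ≈⟨ -‿+-comm (v - u) W′ ⟩
        - ((v - u) + W′)       ≈⟨ -‿cong (sym (x-[y-z]≈x-y+z v u W′)) ⟩
        - (v - (u - W′))       ∎
        where
          u = g (a , b ∷ R)
          v = g (b , a ∷ R)
          W  = ∑± (map _ (map _ (choices R))) g
          W′ = ∑± (map _ (map _ (choices R))) g
          W≈-W′ : W ≈ - W′
          W≈-W′ = begin
            W  ≈⟨ reflexive (≡.trans (∑±-map _ (map _ (choices R)) g) (∑±-map _ (choices R) _)) ⟩
            ∑± (choices R) (λ (x , r) → g (x , a ∷ b ∷ r))
               ≈⟨ ∑±-cong (choices R) (λ (x , r) → g-swap x [] r) ⟩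
            ∑± (choices R) (λ (x , r) → - g (x , b ∷ a ∷ r))
               ≈⟨ ∑±-neg (choices R) _ ⟩
            - ∑± (choices R) (λ (x , r) → g (x , b ∷ a ∷ r))
               ≈⟨ -‿cong (reflexive (≡.sym (≡.trans (∑±-map _ (map _ (choices R)) g) (∑±-map _ (choices R) _)))) ⟩
            - W′ ∎
      ∑±-choices-swap a b (p ∷ P) R g g-swap = begin
        g (p , P ++ a ∷ b ∷ R) - ∑± (map _ (choices (P ++ a ∷ b ∷ R))) g
          ≈⟨ +-cong (g-swap p P R) (-‿cong shifted) ⟩
        - g (p , P ++ b ∷ a ∷ R) - - ∑± (map _ (choices (P ++ b ∷ a ∷ R))) g
          ≈⟨ sym (-‿--distrib _ _) ⟩
        - (g (p , P ++ b ∷ a ∷ R) - ∑± (map _ (choices (P ++ b ∷ a ∷ R))) g) ∎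
        where
          shifted = trans (reflexive (∑±-map _ (choices (P ++ a ∷ b ∷ R)) g))
                    (trans (∑±-choices-swap a b P R _ (λ x Q R′ → g-swap x (p ∷ Q) R′))
                           (-‿cong (reflexive (≡.sym (∑±-map _ (choices (P ++ b ∷ a ∷ R)) g)))))

      pfaffian-swap : ∀ m P a b R → pfaffian A m (P ++ a ∷ b ∷ R) ≈ - pfaffian A m (P ++ b ∷ a ∷ R)
      pfaffian-swap m       []      a b R = pfaffian-swap-head m a b R
      pfaffian-swap zero    (i ∷ P) a b R = sym -0#≈0#
      pfaffian-swap (suc m) (i ∷ P) a b R = ∑±-choices-swap a b P R _ (λ x Q R′ →
        trans (*-congˡ (pfaffian-swap m Q a b R′)) (sym (-‿distribʳ-* _ _)))

      module _ (2-torsionFree : ∀ x → x + x ≈ 0# → x ≈ 0#) where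

        pfaffian-repeat-adjacent : ∀ m P a R → pfaffian A m (P ++ a ∷ a ∷ R) ≈ 0#
        pfaffian-repeat-adjacent m P a R =
          2-torsionFree _ (trans (+-congʳ (pfaffian-swap m P a a R)) (-‿inverseˡ _))

        pfaffian-repeat : ∀ m P a Q R → pfaffian A m (P ++ a ∷ Q ++ a ∷ R) ≈ 0#
        pfaffian-repeat m P a []      R = pfaffian-repeat-adjacent m P a R
        pfaffian-repeat m P a (q ∷ Q) R = begin
          pfaffian A m (P ++ a ∷ q ∷ Q ++ a ∷ R)       ≈⟨ pfaffian-swap m P a q (Q ++ a ∷ R) ⟩
          - pfaffian A m (P ++ q ∷ a ∷ Q ++ a ∷ R)     ≈⟨ -‿cong (reflexive (≡.cong (pfaffian A m)
                                                            (≡.sym (ListP.++-assoc P (q ∷ []) _)))) ⟩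
          - pfaffian A m ((P ++ q ∷ []) ++ a ∷ Q ++ a ∷ R)
                                                       ≈⟨ -‿cong (pfaffian-repeat m (P ++ q ∷ []) a Q R) ⟩
          - 0#                                         ≈⟨ -0#≈0# ⟩
          0#                                           ∎

        pfaffian-∈-head : ∀ m x L → x ∈ L → pfaffian A m (x ∷ L) ≈ 0#
        pfaffian-∈-head m x L x∈L with ∈-∃++ x∈L
        ... | Q , R , ≡.refl = pfaffian-repeat m [] x Q R

        -- Expanding along row i and substituting A i j = - ∑_{x ∈ L} A x j turns
        -- the Pfaffian into - ∑_{x ∈ L} pfaffian (x ∷ L), whose terms repeat x.
        pfaffian-column-sums≈0 : ∀ m i L → (∀ j → ∑ (i ∷ L) (λ x → A x j) ≈ 0#) →
                                 pfaffian A (suc m) (i ∷ L) ≈ 0#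
        pfaffian-column-sums≈0 m i L column≈0 = begin
          ∑± (choices L) (λ (j , r) → A i j * pfaffian A m r)
            ≈⟨ ∑±-cong (choices L) (λ (j , r) → trans (*-congʳ (+-inverseˡ-unique _ _ (column≈0 j)))
                                                     (sym (-‿distribˡ-* _ _))) ⟩
          ∑± (choices L) (λ (j , r) → - (S j * pfaffian A m r))
            ≈⟨ ∑±-neg (choices L) _ ⟩
          - ∑± (choices L) (λ (j , r) → S j * pfaffian A m r)
            ≈⟨ -‿cong (∑±-cong (choices L) (λ (j , r) → sym (∑-*ʳ L (λ x → A x j) _))) ⟩
          - ∑± (choices L) (λ (j , r) → ∑ L (λ x → A x j * pfaffian A m r))
            ≈⟨ -‿cong (∑±-∑ (choices L) L (λ x (j , r) → A x j * pfaffian A m r)) ⟩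
          - ∑ L (λ x → pfaffian A (suc m) (x ∷ L))
            ≈⟨ -‿cong (∑-vanish L _ (λ x x∈L → pfaffian-∈-head (suc m) x L x∈L)) ⟩
          - 0#                                           ≈⟨ -0#≈0# ⟩
          0#                                             ∎
          where
            S : I → Carrier
            S j = ∑ L (λ x → A x j)


bit : Bool → ℕ
bit true  = 1
bit false = 0

T-ext : ∀ {b c} → (T b → T c) → (T c → T b) → b ≡ c
T-ext {false} {false} _ _ = ≡.refl
T-ext {false} {true}  _ g = ⊥-elim (g _)
T-ext {true}  {false} f _ = ⊥-elim (f _)
T-ext {true}  {true}  _ _ = ≡.refl

module _ {A : Set} {P : A → Set} (P? : Decidable P) where

  length-filter-∷ : ∀ x xs → length (filter P? (x ∷ xs)) ≡ bit (does (P? x)) ℕ.+ length (filter P? xs)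
  length-filter-∷ x xs with does (P? x)
  ... | true  = ≡.refl
  ... | false = ≡.refl

  length-filter-++ : ∀ xs ys → length (filter P? (xs ++ ys)) ≡ length (filter P? xs) ℕ.+ length (filter P? ys)
  length-filter-++ xs ys = ≡.trans (≡.cong length (ListP.filter-++ P? xs ys)) (ListP.length-++ (filter P? xs))

allB⇒All : ∀ {A : Set} (f : A → Bool) xs → T (allB f xs) → All (T ∘ f) xs
allB⇒All f []       _ = []
allB⇒All f (x ∷ xs) t = let (fx , rest) = Equivalence.to T-∧ t in fx ∷ allB⇒All f xs rest

All⇒allB : ∀ {A : Set} (f : A → Bool) xs → All (T ∘ f) xs → T (allB f xs)
All⇒allB f []       []         = _
All⇒allB f (x ∷ xs) (fx ∷ fxs) = Equivalence.from T-∧ (fx , All⇒allB f xs fxs)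

-- Monomials as multisets of variables

module _ {m : ℕ} where

  _≟ⱽ_ : DecidableEquality (Var m)
  _≟ⱽ_ = ≡-dec FinP._≟_ (≡-dec FinP._≟_ FinP._≟_)

  ∈-allVars : ∀ v → v ∈ allVars m
  ∈-allVars (i , j , k) =
    ∈-concat⁺′ (∈-concat⁺′ (∈-map⁺ _ (∈-allFin k)) (∈-map⁺ _ (∈-allFin j))) (∈-map⁺ _ (∈-allFin i))

  T-allB-allVars : (f : Var m → Bool) → T (allB f (allVars m)) ⇔ (∀ v → T (f v))
  T-allB-allVars f = mk⇔ (λ t v → All.lookup (allB⇒All f _ t) (∈-allVars v))
                         (λ t → All⇒allB f (allVars m) (All.universal t _))

  countV-∷ : ∀ v x M → countV v (x ∷ M) ≡ bit (does (x ≟ⱽ v)) ℕ.+ countV v M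
  countV-∷ v = length-filter-∷ (_≟ⱽ v)

  countV-++ : ∀ v N M → countV v (N ++ M) ≡ countV v N ℕ.+ countV v M
  countV-++ v = length-filter-++ (_≟ⱽ v)

  T-sameMono : ∀ N M → T (sameMono N M) ⇔ (∀ v → countV v N ≡ countV v M)
  T-sameMono N M = mk⇔
    (λ t v → ℕP.≡ᵇ⇒≡ _ _ (Equivalence.to (T-allB-allVars _) t v))
    (λ e → Equivalence.from (T-allB-allVars _) (λ v → ℕP.≡⇒≡ᵇ _ _ (e v)))

  sameMono-respˡ : ∀ {N N′} M → (∀ v → countV v N ≡ countV v N′) → sameMono N M ≡ sameMono N′ M
  sameMono-respˡ {N} {N′} M N≈N′ = T-ext
    (λ t → Equivalence.from (T-sameMono N′ M) (λ v → ≡.trans (≡.sym (N≈N′ v)) (Equivalence.to (T-sameMono N M) t v)))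
    (λ t → Equivalence.from (T-sameMono N M) (λ v → ≡.trans (N≈N′ v) (Equivalence.to (T-sameMono N′ M) t v)))

  remove : Var m → Mono m → Mono m
  remove x []      = []
  remove x (w ∷ M) = if does (w ≟ⱽ x) then M else w ∷ remove x M

  countV-remove : ∀ v x M → countV v (remove x M) ≡ countV v M ∸ bit (does (x ≟ⱽ v))
  countV-remove v x []      = ≡.sym (ℕP.0∸n≡0 (bit (does (x ≟ⱽ v))))
  countV-remove v x (w ∷ M) with w ≟ⱽ x
  ... | yes ≡.refl = ≡.sym (≡.trans (≡.cong (_∸ bit (does (w ≟ⱽ v))) (countV-∷ v w M))
                                     (ℕP.m+n∸m≡n (bit (does (w ≟ⱽ v))) _))
  ... | no w≢x = begin
    countV v (w ∷ remove x M)                                ≡⟨ countV-∷ v w (remove x M) ⟩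
    bit (does (w ≟ⱽ v)) ℕ.+ countV v (remove x M)            ≡⟨ ≡.cong (bit (does (w ≟ⱽ v)) ℕ.+_) (countV-remove v x M) ⟩
    bit (does (w ≟ⱽ v)) ℕ.+ (countV v M ∸ bit (does (x ≟ⱽ v)))
                                                             ≡⟨ bit-+-∸-comm (w ≟ⱽ v) (x ≟ⱽ v) ⟩
    (bit (does (w ≟ⱽ v)) ℕ.+ countV v M) ∸ bit (does (x ≟ⱽ v)) ≡⟨ ≡.cong (_∸ bit (does (x ≟ⱽ v))) (≡.sym (countV-∷ v w M)) ⟩
    countV v (w ∷ M) ∸ bit (does (x ≟ⱽ v))                   ∎
    where
      open ≡.≡-Reasoning
      -- w and x cannot both be v, so at most one of the two bits is set.
      bit-+-∸-comm : (d : Dec (w ≡ v)) (d′ : Dec (x ≡ v)) →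
                 bit (does d) ℕ.+ (countV v M ∸ bit (does d′)) ≡ (bit (does d) ℕ.+ countV v M) ∸ bit (does d′)
      bit-+-∸-comm (yes ≡.refl) (yes ≡.refl) = ⊥-elim (w≢x ≡.refl)
      bit-+-∸-comm (yes _)      (no _)       = ≡.refl
      bit-+-∸-comm (no _)       _            = ≡.refl

  _∖_ : Mono m → Mono m → Mono m
  M ∖ []      = M
  M ∖ (x ∷ N) = remove x (M ∖ N)

  countV-∖ : ∀ v M N → countV v (M ∖ N) ≡ countV v M ∸ countV v N
  countV-∖ v M []      = ≡.refl
  countV-∖ v M (x ∷ N) = begin
    countV v (remove x (M ∖ N))                         ≡⟨ countV-remove v x (M ∖ N) ⟩
    countV v (M ∖ N) ∸ bit (does (x ≟ⱽ v))              ≡⟨ ≡.cong (_∸ bit (does (x ≟ⱽ v))) (countV-∖ v M N) ⟩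
    countV v M ∸ countV v N ∸ bit (does (x ≟ⱽ v))       ≡⟨ ℕP.∸-+-assoc (countV v M) (countV v N) _ ⟩
    countV v M ∸ (countV v N ℕ.+ bit (does (x ≟ⱽ v)))   ≡⟨ ≡.cong (countV v M ∸_) (ℕP.+-comm (countV v N) _) ⟩
    countV v M ∸ (bit (does (x ≟ⱽ v)) ℕ.+ countV v N)   ≡⟨ ≡.cong (countV v M ∸_) (≡.sym (countV-∷ v x N)) ⟩
    countV v M ∸ countV v (x ∷ N)                       ∎
    where open ≡.≡-Reasoning

  included : Mono m → Mono m → Bool
  included N M = allB (λ v → countV v N ℕ.≤ᵇ countV v M) (allVars m)

  T-included : ∀ N M → T (included N M) ⇔ (∀ v → countV v N ≤ countV v M)
  T-included N M = mk⇔
    (λ t v → ℕP.≤ᵇ⇒≤ _ _ (Equivalence.to (T-allB-allVars _) t v))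
    (λ le → Equivalence.from (T-allB-allVars _) (λ v → ℕP.≤⇒≤ᵇ (le v)))

  sameMono-++ : ∀ N₁ N₂ M → sameMono (N₁ ++ N₂) M ≡ included N₂ M ∧ sameMono N₁ (M ∖ N₂)
  sameMono-++ N₁ N₂ M = T-ext to from
    where
      to : T (sameMono (N₁ ++ N₂) M) → T (included N₂ M ∧ sameMono N₁ (M ∖ N₂))
      to t = Equivalence.from T-∧
        ( Equivalence.from (T-included N₂ M) (λ v → ≡.subst (countV v N₂ ≤_) (sum≡ v) (ℕP.m≤n+m _ _))
        , Equivalence.from (T-sameMono N₁ (M ∖ N₂)) (λ v → ≡.sym (begin
            countV v (M ∖ N₂)                              ≡⟨ countV-∖ v M N₂ ⟩
            countV v M ∸ countV v N₂                        ≡⟨ ≡.cong (_∸ countV v N₂) (≡.sym (sum≡ v)) ⟩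
            countV v N₁ ℕ.+ countV v N₂ ∸ countV v N₂       ≡⟨ ℕP.m+n∸n≡m (countV v N₁) (countV v N₂) ⟩
            countV v N₁                                     ∎)))
        where
          open ≡.≡-Reasoning
          sum≡ : ∀ v → countV v N₁ ℕ.+ countV v N₂ ≡ countV v M
          sum≡ v = ≡.trans (≡.sym (countV-++ v N₁ N₂)) (Equivalence.to (T-sameMono (N₁ ++ N₂) M) t v)
      from : T (included N₂ M ∧ sameMono N₁ (M ∖ N₂)) → T (sameMono (N₁ ++ N₂) M)
      from t = Equivalence.from (T-sameMono (N₁ ++ N₂) M) λ v → begin
        countV v (N₁ ++ N₂)                ≡⟨ countV-++ v N₁ N₂ ⟩
        countV v N₁ ℕ.+ countV v N₂        ≡⟨ ≡.cong (ℕ._+ countV v N₂) (Equivalence.to (T-sameMono N₁ (M ∖ N₂)) N₁≈M∖N₂ v) ⟩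
        countV v (M ∖ N₂) ℕ.+ countV v N₂  ≡⟨ ≡.cong (ℕ._+ countV v N₂) (countV-∖ v M N₂) ⟩
        countV v M ∸ countV v N₂ ℕ.+ countV v N₂
                                           ≡⟨ ℕP.m∸n+n≡m (Equivalence.to (T-included N₂ M) N₂⊆M v) ⟩
        countV v M                         ∎
        where
          open ≡.≡-Reasoning
          N₂⊆M = proj₁ (Equivalence.to T-∧ t)
          N₁≈M∖N₂ = proj₂ (Equivalence.to T-∧ t)

module Coefficients {m : ℕ} where

  open Sums ℤP.+-*-commutativeRing using (∑; ∑-cong; ∑-++; ∑-map; ∑-+; ∑-*ˡ; ∑-*ʳ; ∑-0; ∑-swap)
  open Int using (_+_; _*_; -_)
  open ≡.≡-Reasoning

  weight : ℤ × Mono m → Mono m → ℤ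
  weight (a , N) M = if sameMono N M then a else + 0

  _·_ : ℤ × Mono m → ℤ × Mono m → ℤ × Mono m
  (a , N₁) · (b , N₂) = (a * b , N₁ ++ N₂)

  coeff-∑ : ∀ P M → coeff P M ≡ ∑ P (λ t → weight t M)
  coeff-∑ []            M = ≡.refl
  coeff-∑ ((a , N) ∷ P) M with sameMono N M
  ... | true  = ≡.cong (_+_ a) (coeff-∑ P M)
  ... | false = ≡.trans (coeff-∑ P M) (≡.sym (ℤP.+-identityˡ _))

  ∑-*P : ∀ P Q (g : ℤ × Mono m → ℤ) → ∑ (P *P Q) g ≡ ∑ P (λ s → ∑ Q (λ t → g (s · t)))
  ∑-*P []            Q g = ≡.refl
  ∑-*P ((a , N) ∷ P) Q g =
    ≡.trans (∑-++ (map _ Q) (P *P Q) g) (≡.cong₂ _+_ (∑-map _ Q g) (∑-*P P Q g))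

  coeff-*P : ∀ P Q M → coeff (P *P Q) M ≡ ∑ P (λ s → ∑ Q (λ t → weight (s · t) M))
  coeff-*P P Q M = ≡.trans (coeff-∑ (P *P Q) M) (∑-*P P Q (λ t → weight t M))

  coeff-+P : ∀ P Q M → coeff (P +P Q) M ≡ coeff P M + coeff Q M
  coeff-+P P Q M = begin
    coeff (P ++ Q) M                                  ≡⟨ coeff-∑ (P ++ Q) M ⟩
    ∑ (P ++ Q) (λ t → weight t M)                     ≡⟨ ∑-++ P Q _ ⟩
    ∑ P (λ t → weight t M) + ∑ Q (λ t → weight t M)   ≡⟨ ≡.sym (≡.cong₂ _+_ (coeff-∑ P M) (coeff-∑ Q M)) ⟩
    coeff P M + coeff Q M                             ∎

  coeff-scale : ∀ c P M → coeff (scale c P) M ≡ c * coeff P M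
  coeff-scale c P M = begin
    coeff (scale c P) M                          ≡⟨ coeff-∑ (scale c P) M ⟩
    ∑ (scale c P) (λ t → weight t M)             ≡⟨ ∑-map _ P _ ⟩
    ∑ P (λ (a , N) → weight (c * a , N) M)       ≡⟨ ∑-cong P weight-scale ⟩
    ∑ P (λ t → c * weight t M)                   ≡⟨ ∑-*ˡ P c _ ⟩
    c * ∑ P (λ t → weight t M)                   ≡⟨ ≡.cong (c *_) (≡.sym (coeff-∑ P M)) ⟩
    c * coeff P M                                ∎
    where
      weight-scale : ∀ ((a , N) : ℤ × Mono m) → weight (c * a , N) M ≡ c * weight (a , N) M
      weight-scale (a , N) with sameMono N M
      ... | true  = ≡.refl
      ... | false = ≡.sym (ℤP.*-zeroʳ c)

  weight-·ʳ : ∀ s b N₂ M → weight (s · (b , N₂)) M ≡ (if included N₂ M then weight s (M ∖ N₂) * b else + 0)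
  weight-·ʳ (a , N₁) b N₂ M rewrite sameMono-++ N₁ N₂ M with included N₂ M
  ... | false = ≡.refl
  ... | true with sameMono N₁ (M ∖ N₂)
  ...   | true  = ≡.refl
  ...   | false = ≡.refl

  -- The coefficient of M in P * Q only depends on the coefficients of P.
  coeff-*P-by-right : ∀ P Q M →
    coeff (P *P Q) M ≡ ∑ Q (λ (b , N₂) → if included N₂ M then coeff P (M ∖ N₂) * b else + 0)
  coeff-*P-by-right P Q M = begin
    coeff (P *P Q) M                                             ≡⟨ coeff-*P P Q M ⟩
    ∑ P (λ s → ∑ Q (λ t → weight (s · t) M))                      ≡⟨ ∑-swap P Q _ ⟩
    ∑ Q (λ t → ∑ P (λ s → weight (s · t) M))                      ≡⟨ ∑-cong Q inner ⟩
    ∑ Q (λ (b , N₂) → if included N₂ M then coeff P (M ∖ N₂) * b else + 0) ∎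
    where
      inner : ∀ ((b , N₂) : ℤ × Mono m) →
              ∑ P (λ s → weight (s · (b , N₂)) M) ≡ (if included N₂ M then coeff P (M ∖ N₂) * b else + 0)
      inner (b , N₂) with ∑-cong P (λ s → weight-·ʳ s b N₂ M)
      ... | e with included N₂ M
      ...   | true  = ≡.trans e (≡.trans (∑-*ʳ P _ b) (≡.cong (_* b) (≡.sym (coeff-∑ P (M ∖ N₂)))))
      ...   | false = ≡.trans e (∑-0 P)

  weight-·-comm : ∀ s t M → weight (s · t) M ≡ weight (t · s) M
  weight-·-comm (a , N₁) (b , N₂) M = ≡.cong₂ (λ c d → if c then d else (+ 0))
    (sameMono-respˡ {N = N₁ ++ N₂} {N₂ ++ N₁} M (λ v → ≡.trans (countV-++ v N₁ N₂)
                              (≡.trans (ℕP.+-comm (countV v N₁) _) (≡.sym (countV-++ v N₂ N₁)))))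
    (ℤP.*-comm a b)

  ·-assoc : ∀ s t u → (s · t) · u ≡ s · (t · u)
  ·-assoc (a , N₁) (b , N₂) (c , N₃) = ≡.cong₂ _,_ (ℤP.*-assoc a b c) (ListP.++-assoc N₁ N₂ N₃)

  record _≈ₚ_ (P Q : Poly m) : Set where
    constructor mk≈ₚ
    field coeff-≡ : ∀ M → coeff P M ≡ coeff Q M
  open _≈ₚ_ public

  infix 4 _≈ₚ_

  -P_ : Poly m → Poly m
  -P_ = scale (- + 1)

  *P-comm : ∀ P Q → P *P Q ≈ₚ Q *P P
  *P-comm P Q = mk≈ₚ λ M → begin
    coeff (P *P Q) M                          ≡⟨ coeff-*P P Q M ⟩
    ∑ P (λ s → ∑ Q (λ t → weight (s · t) M))   ≡⟨ ∑-swap P Q _ ⟩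
    ∑ Q (λ t → ∑ P (λ s → weight (s · t) M))   ≡⟨ ∑-cong Q (λ t → ∑-cong P (λ s → weight-·-comm s t M)) ⟩
    ∑ Q (λ t → ∑ P (λ s → weight (t · s) M))   ≡⟨ coeff-*P Q P M ⟨
    coeff (Q *P P) M                          ∎

  *P-congʳ : ∀ {P P′} Q → P ≈ₚ P′ → P *P Q ≈ₚ P′ *P Q
  *P-congʳ {P} {P′} Q P≈P′ = mk≈ₚ λ M → begin
    coeff (P *P Q) M
      ≡⟨ coeff-*P-by-right P Q M ⟩
    ∑ Q (λ (b , N) → if included N M then coeff P (M ∖ N) * b else + 0)
      ≡⟨ ∑-cong Q (λ (b , N) → ≡.cong (λ c → if included N M then c * b else + 0) (coeff-≡ P≈P′ (M ∖ N))) ⟩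
    ∑ Q (λ (b , N) → if included N M then coeff P′ (M ∖ N) * b else + 0)
      ≡⟨ coeff-*P-by-right P′ Q M ⟨
    coeff (P′ *P Q) M ∎

  *P-cong : ∀ {P P′ Q Q′} → P ≈ₚ P′ → Q ≈ₚ Q′ → P *P Q ≈ₚ P′ *P Q′
  *P-cong {P} {P′} {Q} {Q′} P≈P′ Q≈Q′ = mk≈ₚ λ M → begin
    coeff (P *P Q) M    ≡⟨ coeff-≡ (*P-congʳ Q P≈P′) M ⟩
    coeff (P′ *P Q) M   ≡⟨ coeff-≡ (*P-comm P′ Q) M ⟩
    coeff (Q *P P′) M   ≡⟨ coeff-≡ (*P-congʳ P′ Q≈Q′) M ⟩
    coeff (Q′ *P P′) M  ≡⟨ coeff-≡ (*P-comm Q′ P′) M ⟩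
    coeff (P′ *P Q′) M  ∎

  *P-assoc : ∀ P Q R → (P *P Q) *P R ≈ₚ P *P (Q *P R)
  *P-assoc P Q R = mk≈ₚ λ M → begin
    coeff ((P *P Q) *P R) M
      ≡⟨ coeff-∑ ((P *P Q) *P R) M ⟩
    ∑ ((P *P Q) *P R) (λ t → weight t M)
      ≡⟨ ∑-*P (P *P Q) R _ ⟩
    ∑ (P *P Q) (λ st → ∑ R (λ u → weight (st · u) M))
      ≡⟨ ∑-*P P Q _ ⟩
    ∑ P (λ s → ∑ Q (λ t → ∑ R (λ u → weight ((s · t) · u) M)))
      ≡⟨ ∑-cong P (λ s → ∑-cong Q (λ t → ∑-cong R (λ u → ≡.cong (λ v → weight v M) (·-assoc s t u)))) ⟩
    ∑ P (λ s → ∑ Q (λ t → ∑ R (λ u → weight (s · (t · u)) M)))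
      ≡⟨ ∑-cong P (λ s → ∑-*P Q R _) ⟨
    ∑ P (λ s → ∑ (Q *P R) (λ tu → weight (s · tu) M))
      ≡⟨ coeff-*P P (Q *P R) M ⟨
    coeff (P *P (Q *P R)) M ∎

  *P-identityˡ : ∀ P → 1P *P P ≈ₚ P
  *P-identityˡ P = mk≈ₚ λ M → ≡.trans (coeff-*P 1P P M) (≡.trans (ℤP.+-identityʳ _)
    (≡.trans (∑-cong P (λ (b , N) → ≡.cong (λ c → weight (c , N) M) (ℤP.*-identityˡ b))) (≡.sym (coeff-∑ P M))))

  *P-identityʳ : ∀ P → P *P 1P ≈ₚ P
  *P-identityʳ P = mk≈ₚ λ M → ≡.trans (*P-comm P 1P .coeff-≡ M) (*P-identityˡ P .coeff-≡ M)

  *P-distribˡ : ∀ P Q R → P *P (Q +P R) ≈ₚ (P *P Q) +P (P *P R)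
  *P-distribˡ P Q R = mk≈ₚ λ M → begin
    coeff (P *P (Q ++ R)) M                     ≡⟨ coeff-*P P (Q ++ R) M ⟩
    ∑ P (λ s → ∑ (Q ++ R) (λ t → weight (s · t) M))
                                                ≡⟨ ∑-cong P (λ s → ∑-++ Q R _) ⟩
    ∑ P (λ s → ∑ Q (λ t → weight (s · t) M) + ∑ R (λ t → weight (s · t) M))
                                                ≡⟨ ∑-+ P _ _ ⟩
    ∑ P (λ s → ∑ Q (λ t → weight (s · t) M)) + ∑ P (λ s → ∑ R (λ t → weight (s · t) M))
                                                ≡⟨ ≡.cong₂ _+_ (coeff-*P P Q M) (coeff-*P P R M) ⟨
    coeff (P *P Q) M + coeff (P *P R) M         ≡⟨ coeff-+P (P *P Q) (P *P R) M ⟨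
    coeff ((P *P Q) +P (P *P R)) M              ∎

  *P-distribʳ : ∀ P Q R → (Q +P R) *P P ≈ₚ (Q *P P) +P (R *P P)
  *P-distribʳ P Q R = mk≈ₚ λ M → ≡.trans (coeff-*P (Q ++ R) P M) (≡.trans (∑-++ Q R _)
    (≡.sym (≡.trans (coeff-+P (Q *P P) (R *P P) M) (≡.cong₂ _+_ (coeff-*P Q P M) (coeff-*P R P M)))))

  polyRing : CommutativeRing 0ℓ 0ℓ
  polyRing = record
    { Carrier = Poly m
    ; _≈_ = _≈ₚ_
    ; _+_ = _+P_
    ; _*_ = _*P_
    ; -_ = -P_
    ; 0# = 0P
    ; 1# = 1P
    ; isCommutativeRing = record
      { isRing = record
        { +-isAbelianGroup = record
          { isGroup = record
            { isMonoid = record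
              { isSemigroup = record
                { isMagma = record
                  { isEquivalence = record
                    { refl  = mk≈ₚ λ _ → ≡.refl
                    ; sym   = λ e → mk≈ₚ λ M → ≡.sym (coeff-≡ e M)
                    ; trans = λ e e′ → mk≈ₚ λ M → ≡.trans (coeff-≡ e M) (coeff-≡ e′ M)
                    }
                  ; ∙-cong = λ {P} {P′} {Q} {Q′} e e′ → mk≈ₚ λ M →
                      ≡.trans (coeff-+P P Q M) (≡.trans (≡.cong₂ _+_ (coeff-≡ e M) (coeff-≡ e′ M)) (≡.sym (coeff-+P P′ Q′ M)))
                  }
                ; assoc = λ P Q R → mk≈ₚ λ M → ≡.cong (λ S → coeff S M) (ListP.++-assoc P Q R)
                }
              ; identity = (λ P → mk≈ₚ λ _ → ≡.refl)
                         , (λ P → mk≈ₚ λ M → ≡.cong (λ S → coeff S M) (ListP.++-identityʳ P))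
              }
            ; inverse = (λ P → mk≈ₚ λ M → ≡.trans (coeff-+P (-P P) P M)
                                 (≡.trans (≡.cong (_+ coeff P M) (coeff-scale (- + 1) P M)) (-1*x+x≡0 (coeff P M))))
                      , (λ P → mk≈ₚ λ M → ≡.trans (coeff-+P P (-P P) M)
                                 (≡.trans (≡.cong (_+_ (coeff P M)) (coeff-scale (- + 1) P M))
                                          (≡.trans (ℤP.+-comm (coeff P M) _) (-1*x+x≡0 (coeff P M)))))
            ; ⁻¹-cong = λ {P} {Q} e → mk≈ₚ λ M → ≡.trans (coeff-scale (- + 1) P M)
                          (≡.trans (≡.cong (- + 1 *_) (coeff-≡ e M)) (≡.sym (coeff-scale (- + 1) Q M)))
            }
          ; comm = λ P Q → mk≈ₚ λ M → ≡.trans (coeff-+P P Q M)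
                     (≡.trans (ℤP.+-comm (coeff P M) (coeff Q M)) (≡.sym (coeff-+P Q P M)))
          }
        ; *-cong = *P-cong
        ; *-assoc = *P-assoc
        ; *-identity = *P-identityˡ , *P-identityʳ
        ; distrib = *P-distribˡ , *P-distribʳ
        }
      ; *-comm = *P-comm
      }
    }
    where
      -1*x+x≡0 : ∀ x → - + 1 * x + x ≡ + 0
      -1*x+x≡0 x = ≡.trans (≡.cong (_+ x) (ℤP.-1*i≡-i x)) (ℤP.+-inverseˡ x)

  +P-self≈0 : ∀ P → P +P P ≈ₚ 0P → P ≈ₚ 0P
  +P-self≈0 P P+P≈0 = mk≈ₚ λ M → ℤP.*-cancelˡ-≡ (+ 2) (coeff P M) (+ 0)
    (≡.trans (2*x≡x+x (coeff P M)) (≡.trans (≡.sym (coeff-+P P P M)) (coeff-≡ P+P≈0 M)))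
    where
      2*x≡x+x : ∀ x → + 2 * x ≡ x + x
      2*x≡x+x x = ≡.trans (ℤP.*-distribʳ-+ x (+ 1) (+ 1)) (≡.cong₂ _+_ (ℤP.*-identityˡ x) (ℤP.*-identityˡ x))

  coeff≢0⇒∈ : ∀ (P : Poly m) M → ¬ coeff P M ≡ + 0 → ∃ λ t → t ∈ P × T (sameMono (proj₂ t) M)
  coeff≢0⇒∈ []            M c≢0 = ⊥-elim (c≢0 ≡.refl)
  coeff≢0⇒∈ ((a , N) ∷ P) M c≢0 with sameMono N M in e
  ... | true  = (a , N) , here ≡.refl , ≡.subst T (≡.sym e) _
  ... | false = let (t , t∈ , same) = coeff≢0⇒∈ P M c≢0 in t , there t∈ , same

module PolynomialPfaffian {m : ℕ} where

  open Coefficients {m} public using (polyRing; _≈ₚ_; -P_; +P-self≈0; coeff-≡; coeff-scale)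
  open CommutativeRing polyRing public
    using (_≈_; refl; sym; trans; reflexive; +-cong; +-congˡ; +-congʳ; *-cong; *-congˡ; -‿cong; -‿inverseˡ)
  open import Algebra.Properties.Ring (CommutativeRing.ring polyRing) public using (-‿involutive)
  open Pfaffian polyRing public
  open Sums polyRing public

  picks-irrelevant : ∀ {n k} {A : Set} (xs : List A) → picks {n} xs ≡ picks {k} xs
  picks-irrelevant []       = ≡.refl
  picks-irrelevant {n} {k} (x ∷ xs) = ≡.cong (λ ps → (x , xs) ∷ map (λ (z , zs) → (z , x ∷ zs)) ps) (picks-irrelevant {n} {k} xs)

  private
    scale-1 : ∀ P → scale (+ 1) P ≈ P
    scale-1 P = Coefficients.mk≈ₚ λ M → ≡.trans (coeff-scale (+ 1) P M) (ℤP.*-identityˡ _)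

    alt±1 : ∀ {X : Set} (xs : List X) (g : X → Poly m) →
            alt (+ 1) (map g xs) ≈ ∑± xs g × alt (Int.- + 1) (map g xs) ≈ -P ∑± xs g
    alt±1 []       g = refl , refl
    alt±1 (x ∷ xs) g =
      let (pos , neg) = alt±1 xs g in
        +-cong (scale-1 (g x)) neg
      , trans (+-congˡ (trans pos (sym (-‿involutive _)))) (sym (-‿--distrib (g x) (∑± xs g)))

  pf≈pfaffian : ∀ A n (L : List (Fin m)) → pf A n L ≈ pfaffian A n L
  pf≈pfaffian A n       []         = refl
  pf≈pfaffian A zero    (_ ∷ _)    = refl
  pf≈pfaffian A (suc n) (i ∷ rest) = trans (proj₁ (alt±1 (picks {m} rest) _))
    (trans (∑±-cong (picks {m} rest) (λ (j , r) → *-congˡ {A i j} (pf≈pfaffian A n r)))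
           (reflexive (≡.cong (λ ps → ∑± ps (λ (j , r) → A i j *P pfaffian A n r)) (picks-irrelevant {m} {0} rest))))

  concatMap≡∑ : ∀ {X : Set} (f : X → Poly m) xs → concatMap f xs ≡ ∑ xs f
  concatMap≡∑ f []       = ≡.refl
  concatMap≡∑ f (x ∷ xs) = ≡.cong (f x ++_) (concatMap≡∑ f xs)

-- Occurrences of indices

indices-++ : ∀ {m} (N N′ : Mono m) → indices (N ++ N′) ≡ indices N ++ indices N′
indices-++ []                N′ = ≡.refl
indices-++ ((i , j , k) ∷ N) N′ = ≡.cong (λ l → i ∷ j ∷ k ∷ l) (indices-++ N N′)

occ-∷ : ∀ {m} (p x : Fin m) l → occ p (x ∷ l) ≡ bit (does (x FinP.≟ p)) ℕ.+ occ p l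
occ-∷ p = length-filter-∷ (FinP._≟ p)

occ-indices-++ : ∀ {m} (p : Fin m) N N′ → occ p (indices (N ++ N′)) ≡ occ p (indices N) ℕ.+ occ p (indices N′)
occ-indices-++ p N N′ = ≡.trans (≡.cong (occ p) (indices-++ N N′)) (length-filter-++ (FinP._≟ p) (indices N) _)

∈⇒1≤occ : ∀ {m} {x : Fin m} {l} → x ∈ l → 1 ≤ occ x l
∈⇒1≤occ {x = x} {w ∷ l} (here ≡.refl) rewrite occ-∷ x x l with x FinP.≟ x
... | yes _  = ℕ.s≤s ℕ.z≤n
... | no x≢x = ⊥-elim (x≢x ≡.refl)
∈⇒1≤occ {x = x} {w ∷ l} (there x∈l) rewrite occ-∷ x w l = ℕP.≤-trans (∈⇒1≤occ x∈l) (ℕP.m≤n+m _ _)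

length-indices : ∀ {m} (M : Mono m) → length (indices M) ≡ length M ℕ.* 3
length-indices []      = ≡.refl
length-indices (_ ∷ M) = ≡.cong (3 ℕ.+_) (length-indices M)

module _ {m : ℕ} where

  open import Algebra.Properties.CommutativeSemigroup ℕP.+-commutativeSemigroup using (x∙yz≈y∙xz)

  occ-indices-remove : ∀ (p : Fin m) x M → 0 ℕ.< countV x M →
                       occ p (indices M) ≡ occ p (indices (x ∷ [])) ℕ.+ occ p (indices (remove x M))
  occ-indices-remove p x (w ∷ M) count>0 with w ≟ⱽ x | countV-∷ x w M
  ... | yes ≡.refl | _  = occ-indices-++ p (w ∷ []) M
  ... | no _       | eq = begin
    occ p (indices (w ∷ M))                                          ≡⟨ occ-indices-++ p (w ∷ []) M ⟩
    occ p (indices (w ∷ [])) ℕ.+ occ p (indices M)                   ≡⟨ ≡.cong (occ p (indices (w ∷ [])) ℕ.+_)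
                                                                          (occ-indices-remove p x M (≡.subst (0 ℕ.<_) eq count>0)) ⟩
    occ p (indices (w ∷ [])) ℕ.+ (occ p (indices (x ∷ [])) ℕ.+ occ p (indices (remove x M)))
                                                                     ≡⟨ x∙yz≈y∙xz (occ p (indices (w ∷ []))) (occ p (indices (x ∷ []))) _ ⟩
    occ p (indices (x ∷ [])) ℕ.+ (occ p (indices (w ∷ [])) ℕ.+ occ p (indices (remove x M)))
                                                                     ≡⟨ ≡.cong (occ p (indices (x ∷ [])) ℕ.+_)
                                                                          (occ-indices-++ p (w ∷ []) (remove x M)) ⟨
    occ p (indices (x ∷ [])) ℕ.+ occ p (indices (w ∷ remove x M))    ∎
    where open ≡.≡-Reasoning

  countV-∷-self : ∀ x (N : Mono m) → 0 ℕ.< countV x (x ∷ N)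
  countV-∷-self x N rewrite countV-∷ x x N with x ≟ⱽ x
  ... | yes _  = ℕ.s≤s ℕ.z≤n
  ... | no x≢x = ⊥-elim (x≢x ≡.refl)

  countV-≡⇒occ-≡ : ∀ (N M : Mono m) → (∀ v → countV v N ≡ countV v M) → ∀ p → occ p (indices N) ≡ occ p (indices M)
  countV-≡⇒occ-≡ []      []      _   p = ≡.refl
  countV-≡⇒occ-≡ []      (w ∷ M) N≈M p = ⊥-elim (ℕP.<-irrefl (N≈M w) (countV-∷-self w M))
  countV-≡⇒occ-≡ (x ∷ N) M       N≈M p = begin
    occ p (indices (x ∷ N))                                   ≡⟨ occ-indices-++ p (x ∷ []) N ⟩
    occ p (indices (x ∷ [])) ℕ.+ occ p (indices N)            ≡⟨ ≡.cong (occ p (indices (x ∷ [])) ℕ.+_)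
                                                                   (countV-≡⇒occ-≡ N (remove x M) N≈M∖x p) ⟩
    occ p (indices (x ∷ [])) ℕ.+ occ p (indices (remove x M)) ≡⟨ occ-indices-remove p x M
                                                                   (≡.subst (0 ℕ.<_) (N≈M x) (countV-∷-self x N)) ⟨
    occ p (indices M)                                         ∎
    where
      open ≡.≡-Reasoning
      N≈M∖x : ∀ v → countV v N ≡ countV v (remove x M)
      N≈M∖x v = ≡.sym (begin
        countV v (remove x M)                          ≡⟨ countV-remove v x M ⟩
        countV v M ∸ bit (does (x ≟ⱽ v))               ≡⟨ ≡.cong (_∸ bit (does (x ≟ⱽ v))) (N≈M v) ⟨
        countV v (x ∷ N) ∸ bit (does (x ≟ⱽ v))         ≡⟨ ≡.cong (_∸ bit (does (x ≟ⱽ v))) (countV-∷ v x N) ⟩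
        bit (does (x ≟ⱽ v)) ℕ.+ countV v N ∸ bit (does (x ≟ⱽ v)) ≡⟨ ℕP.m+n∸m≡n (bit (does (x ≟ⱽ v))) (countV v N) ⟩
        countV v N                                     ∎)

module Avoiding {m : ℕ} (z : Fin m) where

  open Int using (_*_; -_)

  avoids? : Decidable (λ (t : ℤ × Mono m) → occ z (indices (proj₂ t)) ≡ 0)
  avoids? t = occ z (indices (proj₂ t)) ℕ.≟ 0

  avoiding touching : Poly m → Poly m
  avoiding = filter avoids?
  touching = filter (¬? ∘ avoids?)

  avoiding-++ : ∀ P Q → avoiding (P ++ Q) ≡ avoiding P ++ avoiding Q
  avoiding-++ = ListP.filter-++ avoids?

  avoiding-scale : ∀ c P → avoiding (scale c P) ≡ scale c (avoiding P)
  avoiding-scale c []            = ≡.refl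
  avoiding-scale c ((a , N) ∷ P) with avoids? (a , N)
  ... | yes N-avoids rewrite ListP.filter-accept avoids? {x = (c * a , N)} {xs = scale c P} N-avoids
                           | ListP.filter-accept avoids? {x = (a , N)} {xs = P} N-avoids
    = ≡.cong (_ ∷_) (avoiding-scale c P)
  ... | no N-touches rewrite ListP.filter-reject avoids? {x = (c * a , N)} {xs = scale c P} N-touches
                           | ListP.filter-reject avoids? {x = (a , N)} {xs = P} N-touches
    = avoiding-scale c P

  private
    avoiding-map-avoiding : ∀ (a : ℤ) N → occ z (indices N) ≡ 0 → (Q : Poly m) →
      avoiding (map (λ (b , N′) → (a * b , N ++ N′)) Q) ≡ map (λ (b , N′) → (a * b , N ++ N′)) (avoiding Q)
    avoiding-map-avoiding a N N-avoids []             = ≡.refl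
    avoiding-map-avoiding a N N-avoids ((b , N′) ∷ Q) with avoids? (b , N′)
    ... | yes N′-avoids = ≡.trans
      (ListP.filter-accept avoids? {x = (a * b , N ++ N′)} {xs = map _ Q}
        (≡.trans (occ-indices-++ z N N′) (≡.cong₂ ℕ._+_ N-avoids N′-avoids)))
      (≡.trans (≡.cong (_ ∷_) (avoiding-map-avoiding a N N-avoids Q))
               (≡.cong (map _) (≡.sym (ListP.filter-accept avoids? {x = (b , N′)} {xs = Q} N′-avoids))))
    ... | no N′-touches = ≡.trans
      (ListP.filter-reject avoids? {x = (a * b , N ++ N′)} {xs = map _ Q}
        (λ e → N′-touches (≡.trans (≡.sym (≡.cong (ℕ._+ occ z (indices N′)) N-avoids))
                                   (≡.trans (≡.sym (occ-indices-++ z N N′)) e))))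
      (≡.trans (avoiding-map-avoiding a N N-avoids Q)
               (≡.cong (map _) (≡.sym (ListP.filter-reject avoids? {x = (b , N′)} {xs = Q} N′-touches))))

    avoiding-map-touching : ∀ (a : ℤ) N → ¬ occ z (indices N) ≡ 0 → (Q : Poly m) →
      avoiding (map (λ (b , N′) → (a * b , N ++ N′)) Q) ≡ []
    avoiding-map-touching a N N-touches []             = ≡.refl
    avoiding-map-touching a N N-touches ((b , N′) ∷ Q) = ≡.trans
      (ListP.filter-reject avoids? {x = (a * b , N ++ N′)} {xs = map _ Q}
        (λ e → N-touches (ℕP.m+n≡0⇒m≡0 (occ z (indices N)) (≡.trans (≡.sym (occ-indices-++ z N N′)) e))))
      (avoiding-map-touching a N N-touches Q)

  avoiding-*P : ∀ P Q → avoiding (P *P Q) ≡ avoiding P *P avoiding Q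
  avoiding-*P []            Q = ≡.refl
  avoiding-*P ((a , N) ∷ P) Q with avoids? (a , N)
  ... | yes N-avoids = ≡.trans (avoiding-++ (map _ Q) (P *P Q))
    (≡.trans (≡.cong₂ _++_ (avoiding-map-avoiding a N N-avoids Q) (avoiding-*P P Q))
             (≡.cong (_*P avoiding Q) (≡.sym (ListP.filter-accept avoids? {x = (a , N)} {xs = P} N-avoids))))
  ... | no N-touches = ≡.trans (avoiding-++ (map _ Q) (P *P Q))
    (≡.trans (≡.cong₂ _++_ (avoiding-map-touching a N N-touches Q) (avoiding-*P P Q))
             (≡.cong (_*P avoiding Q) (≡.sym (ListP.filter-reject avoids? {x = (a , N)} {xs = P} N-touches))))

  avoiding-alt : ∀ c ps → avoiding (alt c ps) ≡ alt c (map avoiding ps)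
  avoiding-alt c []       = ≡.refl
  avoiding-alt c (p ∷ ps) = ≡.trans (avoiding-++ (scale c p) (alt (- c) ps))
                                    (≡.cong₂ _++_ (avoiding-scale c p) (avoiding-alt (- c) ps))

  avoiding-pf : ∀ A n L → avoiding (pf A n L) ≡ pf (λ i j → avoiding (A i j)) n L
  avoiding-pf A n       []         = ≡.refl
  avoiding-pf A zero    (_ ∷ _)    = ≡.refl
  avoiding-pf A (suc n) (i ∷ rest) = ≡.trans (avoiding-alt (+ 1) (map expand (picks {m} rest)))
    (≡.cong (alt (+ 1)) (≡.trans (≡.sym (ListP.map-∘ (picks {m} rest))) (ListP.map-cong expand-avoiding (picks {m} rest))))
    where
      expand : Fin m × List (Fin m) → Poly m
      expand (j , r) = A i j *P pf A n r
      expand-avoiding : ∀ ((j , r) : Fin m × List (Fin m)) →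
                        avoiding (expand (j , r)) ≡ avoiding (A i j) *P pf (λ i j → avoiding (A i j)) n r
      expand-avoiding (j , r) = ≡.trans (avoiding-*P (A i j) (pf A n r)) (≡.cong (avoiding (A i j) *P_) (avoiding-pf A n r))

  coeff-avoiding+touching : ∀ P M → coeff P M ≡ coeff (avoiding P) M Int.+ coeff (touching P) M
  coeff-avoiding+touching P M = begin
    coeff P M                                                   ≡⟨ coeff-∑ P M ⟩
    ∑ P (λ t → weight t M)                                      ≡⟨ ∑-partition avoids? P _ ⟩
    ∑ (avoiding P) (λ t → weight t M) Int.+ ∑ (touching P) (λ t → weight t M)
                                                                ≡⟨ ≡.cong₂ Int._+_ (coeff-∑ (avoiding P) M) (coeff-∑ (touching P) M) ⟨
    coeff (avoiding P) M Int.+ coeff (touching P) M             ∎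
    where
      open ≡.≡-Reasoning
      open Sums ℤP.+-*-commutativeRing using (∑; ∑-partition)
      open Coefficients using (weight; coeff-∑)

module Antisymmetry {m : ℕ} where

  open Coefficients using (-P_)

  data Sorting : Fin m → Fin m → Fin m → Set where
    equal₁₂ : ∀ {i k} → Sorting i i k
    equal₂₃ : ∀ {i j} → Sorting i j j
    equal₁₃ : ∀ {i j} → Sorting i j i
    sorted₁₂₃ : ∀ {p q r} → p < q → q < r → Sorting p q r
    sorted₂₁₃ : ∀ {p q r} → p < q → q < r → Sorting q p r
    sorted₁₃₂ : ∀ {p q r} → p < q → q < r → Sorting p r q
    sorted₂₃₁ : ∀ {p q r} → p < q → q < r → Sorting q r p
    sorted₃₁₂ : ∀ {p q r} → p < q → q < r → Sorting r p q
    sorted₃₂₁ : ∀ {p q r} → p < q → q < r → Sorting r q p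

  sorting : ∀ i j k → Sorting i j k
  sorting i j k with FinP.<-cmp i j | FinP.<-cmp j k
  ... | tri≈ _ ≡.refl _ | _               = equal₁₂
  ... | _               | tri≈ _ ≡.refl _ = equal₂₃
  ... | tri< i<j _ _    | tri< j<k _ _    = sorted₁₂₃ i<j j<k
  ... | tri> _ _ j<i    | tri> _ _ k<j    = sorted₃₂₁ k<j j<i
  ... | tri< i<j _ _    | tri> _ _ k<j with FinP.<-cmp i k
  ...   | tri< i<k _ _    = sorted₁₃₂ i<k k<j
  ...   | tri≈ _ ≡.refl _ = equal₁₃
  ...   | tri> _ _ k<i    = sorted₂₃₁ k<i i<j
  sorting i j k | tri> _ _ j<i | tri< j<k _ _ with FinP.<-cmp i k
  ...   | tri< i<k _ _    = sorted₂₁₃ j<i i<k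
  ...   | tri≈ _ ≡.refl _ = equal₁₃
  ...   | tri> _ _ k<i    = sorted₃₁₂ j<k k<i

  swap₁₂ : ∀ {i j k} → Sorting i j k → Sorting j i k
  swap₁₂ equal₁₂         = equal₁₂
  swap₁₂ equal₂₃         = equal₁₃
  swap₁₂ equal₁₃         = equal₂₃
  swap₁₂ (sorted₁₂₃ a b) = sorted₂₁₃ a b
  swap₁₂ (sorted₂₁₃ a b) = sorted₁₂₃ a b
  swap₁₂ (sorted₁₃₂ a b) = sorted₃₁₂ a b
  swap₁₂ (sorted₂₃₁ a b) = sorted₃₂₁ a b
  swap₁₂ (sorted₃₁₂ a b) = sorted₁₃₂ a b
  swap₁₂ (sorted₃₂₁ a b) = sorted₂₃₁ a b

  swap₁₃ : ∀ {i j k} → Sorting i j k → Sorting k j i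
  swap₁₃ equal₁₂         = equal₂₃
  swap₁₃ equal₂₃         = equal₁₂
  swap₁₃ equal₁₃         = equal₁₃
  swap₁₃ (sorted₁₂₃ a b) = sorted₃₂₁ a b
  swap₁₃ (sorted₂₁₃ a b) = sorted₃₁₂ a b
  swap₁₃ (sorted₁₃₂ a b) = sorted₂₃₁ a b
  swap₁₃ (sorted₂₃₁ a b) = sorted₁₃₂ a b
  swap₁₃ (sorted₃₁₂ a b) = sorted₂₁₃ a b
  swap₁₃ (sorted₃₂₁ a b) = sorted₁₂₃ a b

  signedVar : ∀ {i j k} → Sorting i j k → Poly m
  signedVar equal₁₂         = []
  signedVar equal₂₃         = []
  signedVar equal₁₃         = []
  signedVar (sorted₁₂₃ {p} {q} {r} _ _) = var p q r
  signedVar (sorted₂₁₃ {p} {q} {r} _ _) = -P var p q r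
  signedVar (sorted₁₃₂ {p} {q} {r} _ _) = -P var p q r
  signedVar (sorted₂₃₁ {p} {q} {r} _ _) = var p q r
  signedVar (sorted₃₁₂ {p} {q} {r} _ _) = var p q r
  signedVar (sorted₃₂₁ {p} {q} {r} _ _) = -P var p q r

  private
    ≡ᵇ-refl : ∀ n → (n ≡ᵇ n) ≡ true
    ≡ᵇ-refl zero    = ≡.refl
    ≡ᵇ-refl (suc n) = ≡ᵇ-refl n

    <⇒≢ᵇ : ∀ {a b} → a ℕ.< b → (a ≡ᵇ b) ≡ false
    <⇒≢ᵇ {a} {b} a<b = ¬-not (λ e → ℕP.<⇒≢ a<b (ℕP.≡ᵇ⇒≡ a b (Equivalence.from T-≡ e)))

    >⇒≢ᵇ : ∀ {a b} → a ℕ.< b → (b ≡ᵇ a) ≡ false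
    >⇒≢ᵇ {a} {b} a<b = ¬-not (λ e → ℕP.>⇒≢ a<b (ℕP.≡ᵇ⇒≡ b a (Equivalence.from T-≡ e)))

    <⇒<ᵇ : ∀ {a b} → a ℕ.< b → (a <ᵇ b) ≡ true
    <⇒<ᵇ a<b = Equivalence.to T-≡ (ℕP.<⇒<ᵇ a<b)

    >⇒≮ᵇ : ∀ {a b} → a ℕ.< b → (b <ᵇ a) ≡ false
    >⇒≮ᵇ {a} {b} a<b = ¬-not (λ e → ℕP.<-asym a<b (ℕP.<ᵇ⇒< b a (Equivalence.from T-≡ e)))

  y-signedVar : ∀ {i j k} (s : Sorting i j k) → y i j k ≡ signedVar s
  y-signedVar {i} equal₁₂ rewrite ≡ᵇ-refl (toℕ i) = ≡.refl
  y-signedVar {i} {j} equal₂₃ rewrite ≡ᵇ-refl (toℕ j) with toℕ i ≡ᵇ toℕ j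
  ... | true  = ≡.refl
  ... | false = ≡.refl
  y-signedVar {i} {j} equal₁₃ rewrite ≡ᵇ-refl (toℕ i) with toℕ i ≡ᵇ toℕ j | toℕ j ≡ᵇ toℕ i
  ... | true  | _     = ≡.refl
  ... | false | true  = ≡.refl
  ... | false | false = ≡.refl
  y-signedVar (sorted₁₂₃ p<q q<r) rewrite <⇒≢ᵇ p<q | <⇒≢ᵇ q<r | <⇒≢ᵇ (FinP.<-trans p<q q<r)
                                        | <⇒<ᵇ p<q | <⇒<ᵇ q<r = ≡.refl
  y-signedVar (sorted₂₁₃ p<q q<r) rewrite >⇒≢ᵇ p<q | <⇒≢ᵇ (FinP.<-trans p<q q<r) | <⇒≢ᵇ q<r
                                        | >⇒≮ᵇ p<q | <⇒<ᵇ q<r = ≡.refl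
  y-signedVar (sorted₁₃₂ p<q q<r) rewrite <⇒≢ᵇ (FinP.<-trans p<q q<r) | >⇒≢ᵇ q<r | <⇒≢ᵇ p<q
                                        | <⇒<ᵇ (FinP.<-trans p<q q<r) | >⇒≮ᵇ q<r | <⇒<ᵇ p<q = ≡.refl
  y-signedVar (sorted₂₃₁ p<q q<r) rewrite <⇒≢ᵇ q<r | >⇒≢ᵇ (FinP.<-trans p<q q<r) | >⇒≢ᵇ p<q
                                        | <⇒<ᵇ q<r | >⇒≮ᵇ (FinP.<-trans p<q q<r) | >⇒≮ᵇ p<q = ≡.refl
  y-signedVar (sorted₃₁₂ p<q q<r) rewrite >⇒≢ᵇ (FinP.<-trans p<q q<r) | <⇒≢ᵇ p<q | >⇒≢ᵇ q<r
                                        | >⇒≮ᵇ (FinP.<-trans p<q q<r) | >⇒≮ᵇ q<r | <⇒<ᵇ p<q = ≡.refl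
  y-signedVar (sorted₃₂₁ p<q q<r) rewrite >⇒≢ᵇ q<r | >⇒≢ᵇ p<q | >⇒≢ᵇ (FinP.<-trans p<q q<r)
                                        | >⇒≮ᵇ q<r | >⇒≮ᵇ p<q | >⇒≮ᵇ (FinP.<-trans p<q q<r) = ≡.refl

  signedVar-swap₁₂ : ∀ {i j k} (s : Sorting i j k) → signedVar (swap₁₂ s) ≡ -P signedVar s
  signedVar-swap₁₂ equal₁₂         = ≡.refl
  signedVar-swap₁₂ equal₂₃         = ≡.refl
  signedVar-swap₁₂ equal₁₃         = ≡.refl
  signedVar-swap₁₂ (sorted₁₂₃ _ _) = ≡.refl
  signedVar-swap₁₂ (sorted₂₁₃ _ _) = ≡.refl
  signedVar-swap₁₂ (sorted₁₃₂ _ _) = ≡.refl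
  signedVar-swap₁₂ (sorted₂₃₁ _ _) = ≡.refl
  signedVar-swap₁₂ (sorted₃₁₂ _ _) = ≡.refl
  signedVar-swap₁₂ (sorted₃₂₁ _ _) = ≡.refl

  signedVar-swap₁₃ : ∀ {i j k} (s : Sorting i j k) → signedVar (swap₁₃ s) ≡ -P signedVar s
  signedVar-swap₁₃ equal₁₂         = ≡.refl
  signedVar-swap₁₃ equal₂₃         = ≡.refl
  signedVar-swap₁₃ equal₁₃         = ≡.refl
  signedVar-swap₁₃ (sorted₁₂₃ _ _) = ≡.refl
  signedVar-swap₁₃ (sorted₂₁₃ _ _) = ≡.refl
  signedVar-swap₁₃ (sorted₁₃₂ _ _) = ≡.refl
  signedVar-swap₁₃ (sorted₂₃₁ _ _) = ≡.refl
  signedVar-swap₁₃ (sorted₃₁₂ _ _) = ≡.refl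
  signedVar-swap₁₃ (sorted₃₂₁ _ _) = ≡.refl

  y-antisym₁₂ : ∀ i j k → y j i k ≡ -P y i j k
  y-antisym₁₂ i j k = ≡.trans (y-signedVar (swap₁₂ s)) (≡.trans (signedVar-swap₁₂ s) (≡.cong -P_ (≡.sym (y-signedVar s))))
    where s = sorting i j k

  y-antisym₁₃ : ∀ i j k → y k j i ≡ -P y i j k
  y-antisym₁₃ i j k = ≡.trans (y-signedVar (swap₁₃ s)) (≡.trans (signedVar-swap₁₃ s) (≡.cong -P_ (≡.sym (y-signedVar s))))
    where s = sorting i j k

  private
    signedVar-indices : ∀ {i j k} (s : Sorting i j k) {t} → t ∈ signedVar s → indices (proj₂ t) ↭ i ∷ j ∷ k ∷ []
    signedVar-indices (sorted₁₂₃ _ _)         (here ≡.refl) = ↭-refl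
    signedVar-indices (sorted₂₁₃ {p} {q} _ _) (here ≡.refl) = ↭-swap p q ↭-refl
    signedVar-indices (sorted₁₃₂ {p} {q} {r} _ _) (here ≡.refl) = ↭-prep p (↭-swap q r ↭-refl)
    signedVar-indices (sorted₂₃₁ {p} {q} {r} _ _) (here ≡.refl) =
      ↭-trans (↭-swap p q ↭-refl) (↭-prep q (↭-swap p r ↭-refl))
    signedVar-indices (sorted₃₁₂ {p} {q} {r} _ _) (here ≡.refl) =
      ↭-trans (↭-prep p (↭-swap q r ↭-refl)) (↭-swap p r ↭-refl)
    signedVar-indices (sorted₃₂₁ {p} {q} {r} _ _) (here ≡.refl) =
      ↭-trans (↭-swap p q ↭-refl) (↭-trans (↭-prep q (↭-swap p r ↭-refl)) (↭-swap q r ↭-refl))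

  y-support : ∀ i j k {t} → t ∈ y i j k → ∀ {x} → x ∈ i ∷ j ∷ k ∷ [] → x ∈ indices (proj₂ t)
  y-support i j k t∈y x∈ijk = ∈-resp-↭ (↭-sym (signedVar-indices s (≡.subst (_ ∈_) (y-signedVar s) t∈y))) x∈ijk
    where s = sorting i j k

module Support {m : ℕ} where

  open Int using (_*_; -_)
  open Antisymmetry using (y-support)

  ∈-*P⁻ : ∀ P Q {t} → t ∈ P *P Q →
          ∃ λ (s : ℤ × Mono m) → ∃ λ u → s ∈ P × u ∈ Q × proj₂ t ≡ proj₂ s ++ proj₂ u
  ∈-*P⁻ P Q t∈PQ with find (∈-concatMap⁻ _ {xs = P} t∈PQ)
  ... | s , s∈P , t∈sQ with ∈-map⁻ _ t∈sQ
  ...   | u , u∈Q , ≡.refl = s , u , s∈P , u∈Q , ≡.refl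

  ∈-alt⁻ : ∀ c (ps : List (Poly m)) {t} → t ∈ alt c ps →
           ∃ λ (p : Poly m) → ∃ λ t′ → p ∈ ps × t′ ∈ p × proj₂ t ≡ proj₂ t′
  ∈-alt⁻ c (p ∷ ps) t∈ with ∈-++⁻ (scale c p) t∈
  ... | inj₁ t∈cp with ∈-map⁻ _ t∈cp
  ...   | t′ , t′∈p , ≡.refl = p , t′ , here ≡.refl , t′∈p , ≡.refl
  ∈-alt⁻ c (p ∷ ps) t∈ | inj₂ t∈rest =
    let (p′ , t′ , p′∈ , t′∈ , e) = ∈-alt⁻ (- c) ps t∈rest in p′ , t′ , there p′∈ , t′∈ , e

  ∈-∷-picks⁻ : ∀ {A : Set} {i : A} {xs j r x} → (j , r) ∈ picks {m} xs → x ∈ i ∷ xs → x ∈ i ∷ j ∷ [] ⊎ x ∈ r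
  ∈-∷-picks⁻ _                   (here x≡i)            = inj₁ (here x≡i)
  ∈-∷-picks⁻ (here ≡.refl)       (there (here x≡j))    = inj₁ (there (here x≡j))
  ∈-∷-picks⁻ (here ≡.refl)       (there (there x∈r))   = inj₂ x∈r
  ∈-∷-picks⁻ {xs = w ∷ xs} (there jr∈) (there x∈w∷xs) with ∈-map⁻ _ jr∈
  ... | _ , j′r′∈ , ≡.refl with ∈-∷-picks⁻ j′r′∈ x∈w∷xs
  ...   | inj₁ (here x≡w)         = inj₂ (here x≡w)
  ...   | inj₁ (there x∈j)        = inj₁ (there x∈j)
  ...   | inj₂ x∈r                = inj₂ (there x∈r)

  ∈-indices-++⁺ : ∀ (N N′ : Mono m) {x} → x ∈ indices N ⊎ x ∈ indices N′ → x ∈ indices (N ++ N′)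
  ∈-indices-++⁺ N N′ x∈ = ≡.subst (_ ∈_) (≡.sym (indices-++ N N′)) ([ ∈-++⁺ˡ , ∈-++⁺ʳ (indices N) ] x∈)

  Λ-support : ∀ (i j : Fin m) {t} → t ∈ Λ i j → ∀ {x} → x ∈ i ∷ j ∷ [] → x ∈ indices (proj₂ t)
  Λ-support i j t∈Λ x∈ij with find (∈-concatMap⁻ (y i j) {xs = allFin m} t∈Λ)
  ... | k , _ , t∈y = y-support i j k t∈y (∈-++⁺ˡ x∈ij)

  private
    expand : Fin m → ℕ → Fin m × List (Fin m) → Poly m
    expand i n (j , r) = Λ i j *P pf Λ n r

  pf-support : ∀ n (L : List (Fin m)) {t} → t ∈ pf Λ n L → ∀ {x} → x ∈ L → x ∈ indices (proj₂ t)
  expand-support : ∀ i n j r {t} → t ∈ expand i n (j , r) → ∀ {x} → x ∈ i ∷ j ∷ [] ⊎ x ∈ r → x ∈ indices (proj₂ t)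

  pf-support (suc n) (i ∷ rest) t∈ x∈ with ∈-alt⁻ (+ 1) (map (expand i n) (picks {m} rest)) t∈
  ... | q , t′ , q∈ , t′∈q , t≡t′ with ∈-map⁻ (expand i n) q∈
  ...   | (j , r) , jr∈ , ≡.refl = ≡.subst (λ (N : Mono m) → _ ∈ indices N) (≡.sym t≡t′)
                                     (expand-support i n j r t′∈q (∈-∷-picks⁻ jr∈ x∈))

  expand-support i n j r {a , N} t∈ x∈ with ∈-*P⁻ (Λ i j) (pf Λ n r) t∈
  ... | s , u , s∈ , u∈ , ≡.refl =
    ∈-indices-++⁺ (proj₂ s) (proj₂ u) (Sum.map (Λ-support i j s∈) (pf-support n r u∈) x∈)

module _ {m : ℕ} where

  open Support {m} using (∈-*P⁻)

  square-uses-every-index-twice : ∀ (P : Poly m) → (∀ {t} → t ∈ P → ∀ p → 1 ≤ occ p (indices (proj₂ t))) →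
    ∀ M → ¬ coeff (P *P P) M ≡ + 0 → ∀ p → 2 ≤ occ p (indices M)
  square-uses-every-index-twice P uses M c≢0 p with Coefficients.coeff≢0⇒∈ (P *P P) M c≢0
  ... | t , t∈ , same with ∈-*P⁻ P P t∈
  ...   | s , u , s∈ , u∈ , t≡su = ≡.subst (2 ≤_) occ≡ (ℕP.+-mono-≤ (uses s∈ p) (uses u∈ p))
    where
      occ≡ : occ p (indices (proj₂ s)) ℕ.+ occ p (indices (proj₂ u)) ≡ occ p (indices M)
      occ≡ = ≡.trans (≡.sym (occ-indices-++ p (proj₂ s) (proj₂ u)))
             (≡.trans (≡.cong (λ N → occ p (indices N)) (≡.sym t≡su))
                      (countV-≡⇒occ-≡ (proj₂ t) M (Equivalence.to (T-sameMono (proj₂ t) M) same) p))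

module Counting where

  open import Algebra.Properties.CommutativeMonoid.Sum ℕP.+-0-commutativeMonoid
    using (sum; ∑-distrib-+; sum-cong-≗; sum-replicate-zero)

  sum-indicator : ∀ {n} (x : Fin n) → sum (λ p → bit (does (x FinP.≟ p))) ≡ 1
  sum-indicator {suc n} Fin.zero    = ≡.cong suc (sum-replicate-zero n)
  sum-indicator {suc n} (Fin.suc x) = sum-indicator x

  sum-occ : ∀ {n} (l : List (Fin n)) → sum (λ p → occ p l) ≡ length l
  sum-occ {n} []      = sum-replicate-zero n
  sum-occ     (x ∷ l) = begin
    sum (λ p → occ p (x ∷ l))                                       ≡⟨ sum-cong-≗ (λ p → occ-∷ p x l) ⟩
    sum (λ p → bit (does (x FinP.≟ p)) ℕ.+ occ p l)                 ≡⟨ ∑-distrib-+ (λ p → bit (does (x FinP.≟ p))) (λ p → occ p l) ⟩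
    sum (λ p → bit (does (x FinP.≟ p))) ℕ.+ sum (λ p → occ p l)     ≡⟨ ≡.cong₂ ℕ._+_ (sum-indicator x) (sum-occ l) ⟩
    suc (length l)                                                  ∎
    where open ≡.≡-Reasoning

  sum-lower-bound : ∀ {n} k (g : Fin n → ℕ) → (∀ p → k ≤ g p) → n ℕ.* k ≤ sum g
  sum-lower-bound {zero}  k g k≤g = ℕ.z≤n
  sum-lower-bound {suc n} k g k≤g = ℕP.+-mono-≤ (k≤g Fin.zero) (sum-lower-bound k (g ∘ Fin.suc) (k≤g ∘ Fin.suc))

  -- l has 3n entries taking n + 1 values, so not every value occurs three times.
  exactly-twice : ∀ {n} (l : List (Fin (suc n))) → length l ≡ n ℕ.* 3 → (∀ p → 2 ≤ occ p l) → ∃[ p ] occ p l ≡ 2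
  exactly-twice {n} l len twice with FinP.any? (λ p → occ p l ℕ.≟ 2)
  ... | yes found   = found
  ... | no ¬found = ⊥-elim (ℕP.<-irrefl ≡.refl (begin-strict
    n ℕ.* 3         <⟨ ℕP.m<n+m (n ℕ.* 3) (ℕ.s≤s ℕ.z≤n) ⟩
    suc n ℕ.* 3     ≤⟨ sum-lower-bound 3 (λ p → occ p l) thrice ⟩
    sum (λ p → occ p l)  ≡⟨ sum-occ l ⟩
    length l        ≡⟨ len ⟩
    n ℕ.* 3         ∎))
    where
      open ℕP.≤-Reasoning
      thrice : ∀ p → 3 ≤ occ p l
      thrice p = ℕP.≤∧≢⇒< (twice p) (λ two≡ → ¬found (p , ≡.sym two≡))

module PfaffianTree (n : ℕ) where

  m : ℕ
  m = suc (suc n)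

  open Avoiding {m} Fin.zero
  open PolynomialPfaffian {m}
  open Antisymmetry {m} using (y-antisym₁₂; y-antisym₁₃; y-support)
  open Support {m} using (pf-support)
  open import Relation.Binary.Reasoning.Setoid (CommutativeRing.setoid polyRing)

  L₀ : List (Fin m)
  L₀ = drop 1 (allFin m)

  Λ₀ : Fin m → Fin m → Poly m
  Λ₀ i j = avoiding (Λ i j)

  avoiding-∑ : ∀ {X : Set} (xs : List X) (f : X → Poly m) → avoiding (∑ xs f) ≡ ∑ xs (avoiding ∘ f)
  avoiding-∑ []       f = ≡.refl
  avoiding-∑ (x ∷ xs) f = ≡.trans (avoiding-++ (f x) (∑ xs f)) (≡.cong (avoiding (f x) ++_) (avoiding-∑ xs f))

  avoiding-y-zero : ∀ i j → avoiding (y i j Fin.zero) ≡ []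
  avoiding-y-zero i j = ListP.filter-none avoids? (All.tabulate λ t∈ occ≡0 →
    ℕP.<-irrefl (≡.sym occ≡0) (∈⇒1≤occ (y-support i j Fin.zero t∈ (there (there (here ≡.refl))))))

  Λ₀≡∑ : ∀ i j → Λ₀ i j ≡ ∑ L₀ (λ k → avoiding (y i j k))
  Λ₀≡∑ i j = ≡.trans (≡.cong avoiding (concatMap≡∑ (y i j) (allFin m)))
             (≡.trans (avoiding-∑ (allFin m) (y i j)) (≡.cong (_++ ∑ L₀ (λ k → avoiding (y i j k))) (avoiding-y-zero i j)))

  Λ₀-antisym : ∀ i j → Λ₀ j i ≈ -P Λ₀ i j
  Λ₀-antisym i j = begin
    Λ₀ j i                                       ≡⟨ Λ₀≡∑ j i ⟩
    ∑ L₀ (λ k → avoiding (y j i k))              ≈⟨ ∑-cong L₀ (λ k → reflexive (≡.trans (≡.cong avoiding (y-antisym₁₂ i j k))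
                                                                        (avoiding-scale (Int.- + 1) (y i j k)))) ⟩
    ∑ L₀ (λ k → -P avoiding (y i j k))           ≈⟨ ∑-neg L₀ _ ⟩
    -P ∑ L₀ (λ k → avoiding (y i j k))           ≡⟨ ≡.cong -P_ (Λ₀≡∑ i j) ⟨
    -P Λ₀ i j                                    ∎

  -- Antisymmetry of y in its outer indices makes the double sum equal to its negative.
  Λ₀-column-sum≈0 : ∀ j → ∑ L₀ (λ x → Λ₀ x j) ≈ 0P
  Λ₀-column-sum≈0 j = trans (∑-cong L₀ (λ x → reflexive (Λ₀≡∑ x j))) (+P-self≈0 D (trans (+-congʳ D≈-D) (-‿inverseˡ D)))
    where
      D : Poly m
      D = ∑ L₀ (λ x → ∑ L₀ (λ k → avoiding (y x j k)))
      D≈-D : D ≈ -P D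
      D≈-D = begin
        ∑ L₀ (λ x → ∑ L₀ (λ k → avoiding (y x j k)))         ≈⟨ ∑-cong L₀ (λ x → ∑-cong L₀ (λ k → reflexive (
                                                                  ≡.trans (≡.cong avoiding (y-antisym₁₃ k j x))
                                                                          (avoiding-scale (Int.- + 1) (y k j x))))) ⟩
        ∑ L₀ (λ x → ∑ L₀ (λ k → -P avoiding (y k j x)))      ≈⟨ ∑-cong L₀ (λ x → ∑-neg L₀ _) ⟩
        ∑ L₀ (λ x → -P ∑ L₀ (λ k → avoiding (y k j x)))      ≈⟨ ∑-neg L₀ _ ⟩
        -P ∑ L₀ (λ x → ∑ L₀ (λ k → avoiding (y k j x)))      ≈⟨ -‿cong (∑-swap L₀ L₀ _) ⟩
        -P D                                                  ∎

  avoiding-𝒫≈0 : avoiding (𝒫 m) ≈ 0P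
  avoiding-𝒫≈0 = begin
    avoiding (pf Λ m L₀)      ≡⟨ avoiding-pf Λ m L₀ ⟩
    pf Λ₀ m L₀                ≈⟨ pf≈pfaffian Λ₀ m L₀ ⟩
    pfaffian Λ₀ m L₀          ≈⟨ pfaffian-column-sums≈0 Λ₀ Λ₀-antisym +P-self≈0 (suc n) (Fin.suc Fin.zero)
                                   (List.tabulate (Fin.suc ∘ Fin.suc)) Λ₀-column-sum≈0 ⟩
    0P                        ∎

  𝒫≈touching : 𝒫 m ≈ touching (𝒫 m)
  𝒫≈touching = Coefficients.mk≈ₚ λ M → ≡.trans (coeff-avoiding+touching (𝒫 m) M)
    (≡.trans (≡.cong (Int._+ coeff (touching (𝒫 m)) M) (coeff-≡ avoiding-𝒫≈0 M)) (ℤP.+-identityˡ _))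

  touching-uses-every-index : ∀ {t} → t ∈ touching (𝒫 m) → ∀ p → 1 ≤ occ p (indices (proj₂ t))
  touching-uses-every-index t∈ Fin.zero    = ℕP.n≢0⇒n>0 (proj₂ (∈-filter⁻ (¬? ∘ avoids?) {xs = 𝒫 m} t∈))
  touching-uses-every-index t∈ (Fin.suc q) =
    ∈⇒1≤occ (pf-support m L₀ (proj₁ (∈-filter⁻ (¬? ∘ avoids?) {xs = 𝒫 m} t∈)) (∈-tabulate⁺ {f = Fin.suc} q))

  nonzero⇒twice : ∀ M → ¬ coeff (𝒫 m *P 𝒫 m) M ≡ + 0 → ∀ p → 2 ≤ occ p (indices M)
  nonzero⇒twice M c≢0 = square-uses-every-index-twice (touching (𝒫 m)) touching-uses-every-index M
    (λ c≡0 → c≢0 (≡.trans (coeff-≡ (*-cong 𝒫≈touching 𝒫≈touching) M) c≡0))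

lemma6p6 : (m : ℕ) → m % 2 ≡ 1 → 3 ≤ m →
    (M : List (Var m)) → length M ≡ m ∸ 1 →
    All (λ { (i , j , k) → (i < j) × (j < k) }) M →
    ¬ (coeff (𝒫 m *P 𝒫 m) M ≡ + 0) →
    ∃[ p ] (occ p (indices M) ≡ 2)
lemma6p6 zero          _ ()               _ _   _ _
lemma6p6 (suc zero)    _ (ℕ.s≤s ())       _ _   _ _
lemma6p6 (suc (suc n)) _ _ M len _ c≢0 =
  Counting.exactly-twice (indices M) (≡.trans (length-indices M) (≡.cong (ℕ._* 3) len)) (PfaffianTree.nonzero⇒twice n M c≢0)
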